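{- Let $\mathbb{F}=\mathbb{F}_q$ be a finite field, $d\ge 2$ and $\epsilon>0$ fixed, and $r=r(n)\le(1-\epsilon)n/2$. Let $T$ be drawn from $\mathcal{T}^{(r)}_{d,n}(\mathbb{F})$. Then for any $c>0$, $$\Pr_T[\,r-c\le \mathrm{ark}(T)\le r\,]\ge (1+o(1))(1-q^{ -c})\quad\text{as } n\to\infty.$$
   Context: A $d$-linear form is a map $T\colon(\mathbb{F}^n)^d\to\mathbb{F}$ linear in each of its $d$ vector variables. $\mathrm{bias}(T)=\Pr[T=0]-\Pr[T=y]$ for any nonzero $y\in\mathbb{F}$ (uniform random point of $(\mathbb{F}^n)^d$), and the analytic rank is $\mathrm{ark}(T)=-\log_{|\mathbb{F}|}\mathrm{bias}(T)$. The distribution $\mathcal{T}^{(r)}_{d,n}(\mathbb{F})$ is that of $T=\sum_{i=1}^r S_iR_i$, a sum of $r$ independent random reducible $d$-linear forms: for each $i$ there is a (fixed) nonempty proper subset $I_i\subsetneq[d]$ of the vector variables, and $S_i$, $R_i$ are independent uniformly random multilinear forms in the variables indexed by $I_i$ and by $[d]\setminus I_i$ respectively.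
   Formalization: The parameters ε and c range over the positive rationals. -}

module Defs where

open import Level using (0ℓ)
open import Data.Bool using (Bool; true; false; _∧_)
open import Data.Nat as ℕ using (ℕ; zero; suc)
open import Data.Integer as ℤ using (ℤ)
open import Data.Rational as ℚ using (ℚ; _≤_; _<_)
open import Data.Fin using (Fin)
open import Data.Fin.Subset using (Subset; ∁; Nonempty)
open import Data.Fin.Subset.Properties using (_∈?_)
open import Data.List using (List; []; _∷_; length; map; filter; allFin; zipWith; foldr; concatMap; _++_)
open import Data.List.Membership.Propositional using (_∈_)
open import Data.List.Relation.Unary.Unique.Propositional using (Unique)
open import Data.Vec using (Vec; lookup; toList)
import Data.Vec as Vec
open import Data.Product using (∃; _×_; _,_)
open import Algebra.Core using (Op₁; Op₂)
open import Algebra.Structures using (IsCommutativeRing)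
open import Relation.Binary.PropositionalEquality using (_≡_; _≢_)
open import Relation.Binary.Definitions using (DecidableEquality)
open import Relation.Nullary using (does)

record FiniteField : Set₁ where
  field
    Carrier  : Set
    _+_ _*_  : Op₂ Carrier
    -_       : Op₁ Carrier
    0# 1#    : Carrier
    isCommutativeRing : IsCommutativeRing _≡_ _+_ _*_ -_ 0# 1#
    0≢1      : 0# ≢ 1#
    inverse  : ∀ x → x ≢ 0# → ∃ λ y → x * y ≡ 1#
    _≟_      : DecidableEquality Carrier
    elements : List Carrier
    elements-complete : ∀ x → x ∈ elements
    elements-unique   : Unique elements

  order : ℕ
  order = length elements

allVecsOf : ∀ {A : Set} → List A → (k : ℕ) → List (Vec A k)
allVecsOf xs zero    = Vec.[] ∷ []
allVecsOf xs (suc k) = concatMap (λ x → map (x Vec.∷_) (allVecsOf xs k)) xs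

countᵇ : ∀ {A : Set} → (A → Bool) → List A → ℕ
countᵇ p []       = 0
countᵇ p (x ∷ xs) with p x
... | true  = suc (countᵇ p xs)
... | false = countᵇ p xs

-- the ratio a / b as a rational (b = 0 never occurs in uses below)
ratio : ℤ → ℕ → ℚ
ratio a zero    = ℚ.0ℚ
ratio a (suc b) = a ℚ./ suc b

_^ℚ_ : ℚ → ℕ → ℚ
p ^ℚ zero  = ℚ.1ℚ
p ^ℚ suc k = p ℚ.* (p ^ℚ k)

module _ (F : FiniteField) where
  open FiniteField F

  Point : ℕ → ℕ → Set
  Point d n = Vec (Vec Carrier n) d

  allPoints : (d n : ℕ) → List (Point d n)
  allPoints d n = allVecsOf (allVecsOf elements n) d

  sumF : List Carrier → Carrier
  sumF = foldr _+_ 0#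

  vars : ∀ {d} → Subset d → List (Fin d)
  vars {d} I = filter (_∈? I) (allFin d)

  monomial : ∀ {d n} (J : List (Fin d)) → Vec (Fin n) (length J) → Point d n → Carrier
  monomial []      Vec.[]       x = 1#
  monomial (j ∷ J) (k Vec.∷ ks) x = lookup (lookup x j) k * monomial J ks x

  multiIndices : ∀ {d} (n : ℕ) (J : List (Fin d)) → List (Vec (Fin n) (length J))
  multiIndices n J = allVecsOf (allFin n) (length J)

  formOf : ∀ {d n} (J : List (Fin d)) → List Carrier → Point d n → Carrier
  formOf {n = n} J cs x = sumF (zipWith (λ c k → c * monomial J k x) cs (multiIndices n J))

  -- all multilinear forms in the variables indexed by I (one list entry per
  -- coefficient tensor, i.e. the uniform distribution on such forms)
  allForms : ∀ {d} (n : ℕ) → Subset d → List (Point d n → Carrier)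
  allForms n I =
    map (λ cs → formOf (vars I) (toList cs))
        (allVecsOf elements (length (multiIndices n (vars I))))

  -- the sample space of T = Σ_i S_i R_i  (uniform over the list)
  randomT : ∀ {d} (n : ℕ) → List (Subset d) → List (Point d n → Carrier)
  randomT n []       = (λ _ → 0#) ∷ []
  randomT n (I ∷ Is) =
    concatMap (λ S → concatMap (λ R → map (λ T′ x → (S x * R x) + T′ x)
                                         (randomT n Is))
                               (allForms n (∁ I)))
              (allForms n I)

  isᵇ : Carrier → Carrier → Bool
  isᵇ a b = does (a ≟ b)

  -- bias(T) = Pr[T = 0] − Pr[T = 1]   (y = 1 as the nonzero value)
  bias : ∀ {d n} → (Point d n → Carrier) → ℚ
  bias {d} {n} T =
    ratio (ℤ.+ countᵇ (λ x → isᵇ (T x) 0#) (allPoints d n)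
             ℤ.- ℤ.+ countᵇ (λ x → isᵇ (T x) 1#) (allPoints d n))
          (length (allPoints d n))

  -- "r − a/b ≤ ark(T) ≤ r", where ark(T) = −log_q bias(T), unfolded:
  --   ark(T) ≤ r         ⇔  q^{-r} ≤ bias(T)
  --   r − a/b ≤ ark(T)   ⇔  bias(T) ≤ q^{a/b − r}  ⇔  bias(T)^b ≤ q^a / q^{rb}
  --                          (using bias(T) > 0, guaranteed by the first item)
  arkInRangeᵇ : ∀ {d n} → (r a b : ℕ) → (Point d n → Carrier) → Bool
  arkInRangeᵇ r a b T =
    (ratio (ℤ.+ 1) (order ℕ.^ r) ℚ.≤ᵇ bias T)
    ∧ ((bias T ^ℚ b) ℚ.≤ᵇ ratio (ℤ.+ (order ℕ.^ a)) (order ℕ.^ (r ℕ.* b)))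

  probArkInRange : ∀ {d} (n r a b : ℕ) → List (Subset d) → ℚ
  probArkInRange n r a b Is =
    ratio (ℤ.+ countᵇ (arkInRangeᵇ r a b) (randomT n Is))
          (length (randomT n Is))

{-# OPTIONS --safe #-}
-- Write T = Σᵢ Sᵢ Rᵢ and single out the first variable x₀. In each term one factor is additive in x₀
-- and the other does not involve x₀, so T(·, y) ≡ 0 as soon as the r factors not involving x₀ (multilinear
-- forms in the remaining variables y) vanish at y. Each such condition cuts the number of y by at most a
-- factor q, and T(·, y) has at least as many zeros as ones for every y, so bias(T) ≥ q⁻ʳ, i.e. ark(T) ≤ r.
-- Conversely, at a point x with no zero component every Sᵢ(x) and Rᵢ(x) is uniform on F, which gives
-- Pr_T[T(x) = 0] - Pr_T[T(x) = 1] = q⁻ʳ exactly; the other points have density at most d q⁻ⁿ, so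
-- E[bias(T)] ≤ q⁻ʳ (1 + d qʳ⁻ⁿ). Markov's inequality then bounds the probability of ark(T) < r - c by
-- q⁻ᶜ (1 + d qʳ⁻ⁿ) (compared after raising to the power b, as c = a/b), and r ≤ n/2 makes qʳ⁻ⁿ tend to 0.
module Submission where

open import Defs

module Sums where

  open import Data.Nat as ℕ using (ℕ; zero; suc; _+_; _*_; _^_; _≤_; z≤n; s≤s)
  import Data.Nat.Properties as ℕₚ
  open import Data.Nat.Tactic.RingSolver using (solve-∀)
  open import Data.Bool using (Bool; true; false; not; _∧_; _∨_)
  open import Data.List using (List; []; _∷_; length; map; concatMap; _++_)
  import Data.List.Properties as Listₚ
  open import Data.List.Relation.Unary.All using (All; []; _∷_)
  open import Data.List.Relation.Unary.Any using (here)
  open import Data.List.Membership.Propositional using (_∈_; lose)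
  import Data.List.Membership.Propositional.Properties as Membershipₚ
  open import Data.Vec as Vec using (Vec) renaming ([] to []ᵥ; _∷_ to _∷ᵥ_)
  open import Data.Fin using (zero; suc)
  open import Data.Product using (∃; _×_; _,_)
  open import Data.Sum using (_⊎_; inj₁; inj₂)
  open import Data.Empty using (⊥-elim)
  open import Function using (_∘_)
  open import Relation.Nullary using (yes; no)
  open import Relation.Binary.PropositionalEquality

  χ : Bool → ℕ
  χ true  = 1
  χ false = 0

  χ-∧ : ∀ a b → χ (a ∧ b) ≡ χ a * χ b
  χ-∧ true  b = sym (ℕₚ.+-identityʳ (χ b))
  χ-∧ false b = refl

  χ≤1 : ∀ b → χ b ≤ 1
  χ≤1 true  = ℕₚ.≤-refl
  χ≤1 false = z≤n

  ∧≡true⁻ : ∀ {a b} → a ∧ b ≡ true → a ≡ true × b ≡ true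
  ∧≡true⁻ {true} b≡true = refl , b≡true

  ∨≡false⁻ : ∀ {a b} → a ∨ b ≡ false → a ≡ false × b ≡ false
  ∨≡false⁻ {false} b≡false = refl , b≡false

  χ-∨ : ∀ a b → χ (a ∨ b) ≤ χ a + χ b
  χ-∨ true  b = s≤s z≤n
  χ-∨ false b = ℕₚ.≤-refl

  not≡true⁻ : ∀ {a} → not a ≡ true → a ≡ false
  not≡true⁻ {false} _ = refl

  χ≢0⇒≡true : ∀ {a} → χ a ≢ 0 → a ≡ true
  χ≢0⇒≡true {true}  _   = refl
  χ≢0⇒≡true {false} χ≢0 = ⊥-elim (χ≢0 refl)

  ∑ : ∀ {A : Set} → List A → (A → ℕ) → ℕ
  ∑ []       f = 0
  ∑ (x ∷ xs) f = f x + ∑ xs f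

  syntax ∑ xs (λ x → e) = ∑[ x ← xs ] e

  module _ {A : Set} where

    ∑-cong : ∀ (xs : List A) {f g : A → ℕ} → (∀ x → f x ≡ g x) → ∑ xs f ≡ ∑ xs g
    ∑-cong []       e = refl
    ∑-cong (x ∷ xs) e = cong₂ _+_ (e x) (∑-cong xs e)

    ∑-cong-All : ∀ {P : A → Set} (xs : List A) {f g : A → ℕ} → All P xs → (∀ x → P x → f x ≡ g x) → ∑ xs f ≡ ∑ xs g
    ∑-cong-All []       []         e = refl
    ∑-cong-All (x ∷ xs) (px ∷ pxs) e = cong₂ _+_ (e x px) (∑-cong-All xs pxs e)

    ∑-mono : ∀ (xs : List A) {f g : A → ℕ} → (∀ x → f x ≤ g x) → ∑ xs f ≤ ∑ xs g
    ∑-mono []       e = z≤n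
    ∑-mono (x ∷ xs) e = ℕₚ.+-mono-≤ (e x) (∑-mono xs e)

    ∑-++ : ∀ (xs ys : List A) (f : A → ℕ) → ∑ (xs ++ ys) f ≡ ∑ xs f + ∑ ys f
    ∑-++ []       ys f = refl
    ∑-++ (x ∷ xs) ys f = trans (cong (f x +_) (∑-++ xs ys f)) (sym (ℕₚ.+-assoc (f x) _ _))

    ∑-+ : ∀ (xs : List A) (f g : A → ℕ) → ∑[ x ← xs ] (f x + g x) ≡ ∑ xs f + ∑ xs g
    ∑-+ []       f g = refl
    ∑-+ (x ∷ xs) f g = trans (cong (f x + g x +_) (∑-+ xs f g)) (+-interchange (f x) (g x) _ _)
      where
      +-interchange : ∀ a b c d → (a + b) + (c + d) ≡ (a + c) + (b + d)
      +-interchange = solve-∀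

    ∑-*ˡ : ∀ (xs : List A) (c : ℕ) (f : A → ℕ) → ∑[ x ← xs ] (c * f x) ≡ c * ∑ xs f
    ∑-*ˡ []       c f = sym (ℕₚ.*-zeroʳ c)
    ∑-*ˡ (x ∷ xs) c f = trans (cong (c * f x +_) (∑-*ˡ xs c f)) (sym (ℕₚ.*-distribˡ-+ c (f x) _))

    ∑-*ʳ : ∀ (xs : List A) (c : ℕ) (f : A → ℕ) → ∑[ x ← xs ] (f x * c) ≡ ∑ xs f * c
    ∑-*ʳ xs c f = trans (∑-cong xs (λ x → ℕₚ.*-comm (f x) c)) (trans (∑-*ˡ xs c f) (ℕₚ.*-comm c _))

    ∑-const : ∀ (xs : List A) (c : ℕ) → ∑[ _ ← xs ] c ≡ length xs * c
    ∑-const []       c = refl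
    ∑-const (x ∷ xs) c = cong (c +_) (∑-const xs c)

    ∑-one : ∀ (xs : List A) → ∑[ _ ← xs ] 1 ≡ length xs
    ∑-one xs = trans (∑-const xs 1) (ℕₚ.*-identityʳ (length xs))

    ∑-zero : ∀ (xs : List A) → ∑[ _ ← xs ] 0 ≡ 0
    ∑-zero xs = trans (∑-const xs 0) (ℕₚ.*-zeroʳ (length xs))

    ∑-χ≤length : ∀ (xs : List A) (p : A → Bool) → ∑ xs (χ ∘ p) ≤ length xs
    ∑-χ≤length xs p = ℕₚ.≤-trans (∑-mono xs (χ≤1 ∘ p)) (ℕₚ.≤-reflexive (∑-one xs))

    countᵇ≡∑χ : ∀ (p : A → Bool) (xs : List A) → countᵇ p xs ≡ ∑ xs (χ ∘ p)
    countᵇ≡∑χ p []       = refl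
    countᵇ≡∑χ p (x ∷ xs) with p x
    ... | true  = cong suc (countᵇ≡∑χ p xs)
    ... | false = countᵇ≡∑χ p xs

    countᵇ+countᵇ-not : ∀ (p : A → Bool) (xs : List A) → countᵇ p xs + countᵇ (not ∘ p) xs ≡ length xs
    countᵇ+countᵇ-not p []       = refl
    countᵇ+countᵇ-not p (x ∷ xs) with p x
    ... | true  = cong suc (countᵇ+countᵇ-not p xs)
    ... | false = trans (ℕₚ.+-suc _ _) (cong suc (countᵇ+countᵇ-not p xs))

  module _ {A B : Set} where

    ∑-map : ∀ (g : A → B) (xs : List A) (f : B → ℕ) → ∑ (map g xs) f ≡ ∑ xs (f ∘ g)
    ∑-map g []       f = refl
    ∑-map g (x ∷ xs) f = cong (f (g x) +_) (∑-map g xs f)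

    ∑-concatMap : ∀ (g : A → List B) (xs : List A) (f : B → ℕ) →
                  ∑ (concatMap g xs) f ≡ ∑[ x ← xs ] ∑ (g x) f
    ∑-concatMap g []       f = refl
    ∑-concatMap g (x ∷ xs) f = trans (∑-++ (g x) _ f) (cong (∑ (g x) f +_) (∑-concatMap g xs f))

    ∑-swap : ∀ (xs : List A) (ys : List B) (f : A → B → ℕ) →
             ∑[ x ← xs ] ∑[ y ← ys ] f x y ≡ ∑[ y ← ys ] ∑[ x ← xs ] f x y
    ∑-swap []       ys f = sym (∑-zero ys)
    ∑-swap (x ∷ xs) ys f = trans (cong (∑ ys (f x) +_) (∑-swap xs ys f)) (sym (∑-+ ys (f x) _))

  ∑≡0⊎witness : ∀ {A : Set} (xs : List A) (f : A → ℕ) → ∑ xs f ≡ 0 ⊎ ∃ λ x → f x ≢ 0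
  ∑≡0⊎witness []       f = inj₁ refl
  ∑≡0⊎witness (x ∷ xs) f with f x ℕ.≟ 0 | ∑≡0⊎witness xs f
  ... | no fx≢0  | _               = inj₂ (x , fx≢0)
  ... | yes fx≡0 | inj₁ rest≡0     = inj₁ (cong₂ _+_ fx≡0 rest≡0)
  ... | yes _    | inj₂ witness    = inj₂ witness

  length-concatMap : ∀ {A B : Set} (g : A → List B) (xs : List A) → length (concatMap g xs) ≡ ∑[ x ← xs ] length (g x)
  length-concatMap g []       = refl
  length-concatMap g (x ∷ xs) = trans (Listₚ.length-++ (g x)) (cong (length (g x) +_) (length-concatMap g xs))

  ∈-allVecsOf : ∀ {A : Set} (xs : List A) {k} (v : Vec A k) → (∀ i → Vec.lookup v i ∈ xs) → v ∈ allVecsOf xs k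
  ∈-allVecsOf xs []ᵥ       _      = here refl
  ∈-allVecsOf xs (a ∷ᵥ v) v⊆xs =
    Membershipₚ.∈-concatMap⁺ _ (lose (v⊆xs zero) (Membershipₚ.∈-map⁺ (a ∷ᵥ_) (∈-allVecsOf xs v (v⊆xs ∘ suc))))

  module _ {A : Set} (xs : List A) where

    length-allVecsOf : ∀ k → length (allVecsOf xs k) ≡ length xs ^ k
    length-allVecsOf zero    = refl
    length-allVecsOf (suc k) = begin
      length (allVecsOf xs (suc k))                      ≡⟨ length-concatMap _ xs ⟩
      ∑[ x ← xs ] length (map (x ∷ᵥ_) (allVecsOf xs k))  ≡⟨ ∑-cong xs (λ x → Listₚ.length-map (x ∷ᵥ_) (allVecsOf xs k)) ⟩
      ∑[ x ← xs ] length (allVecsOf xs k)                ≡⟨ ∑-const xs _ ⟩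
      length xs * length (allVecsOf xs k)                ≡⟨ cong (length xs *_) (length-allVecsOf k) ⟩
      length xs ^ suc k                                  ∎
      where open ≡-Reasoning

    ∑-allVecsOf-suc : ∀ k (f : Vec A (suc k) → ℕ) →
                      ∑ (allVecsOf xs (suc k)) f ≡ ∑[ x ← xs ] ∑[ v ← allVecsOf xs k ] f (x ∷ᵥ v)
    ∑-allVecsOf-suc k f = trans (∑-concatMap _ xs f) (∑-cong xs (λ x → ∑-map (x ∷ᵥ_) (allVecsOf xs k) f))

module Powers where

  open Sums
  open import Data.Nat as ℕ using (ℕ; zero; suc; _+_; _*_; _^_; _∸_; _≤_; _<_; z≤n; s≤s; >-nonZero)
  import Data.Nat.Properties as ℕₚ
  open import Data.Nat.Tactic.RingSolver using (solve-∀)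
  open import Data.Bool using (Bool; true; false)
  open import Data.List using ([]; _∷_)
  open import Data.List.Relation.Unary.Any using (here; there)
  open import Data.List.Membership.Propositional using (_∈_)
  open import Data.Empty using (⊥-elim)
  open import Data.Product using (∃; _×_; _,_)
  open import Data.Sum using (_⊎_; inj₁; inj₂)
  open import Function using (_∘_)
  open import Relation.Nullary using (yes; no)
  open import Relation.Binary.PropositionalEquality

  ^-distribʳ-* : ∀ m n b → (m * n) ^ b ≡ m ^ b * n ^ b
  ^-distribʳ-* m n zero    = refl
  ^-distribʳ-* m n (suc b) = trans (cong (m * n *_) (^-distribʳ-* m n b)) (interchange m n (m ^ b) (n ^ b))
    where
    interchange : ∀ a b c d → a * b * (c * d) ≡ a * c * (b * d)
    interchange = solve-∀

  ^-cancelˡ-≤ : ∀ {m n} b → 1 ≤ b → m ^ b ≤ n ^ b → m ≤ n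
  ^-cancelˡ-≤ {m} {n} b 1≤b mᵇ≤nᵇ with m ℕ.≤? n
  ... | yes m≤n = m≤n
  ... | no  m≰n = ⊥-elim (ℕₚ.<⇒≱ (ℕₚ.^-monoˡ-< b {{>-nonZero 1≤b}} (ℕₚ.≰⇒> m≰n)) mᵇ≤nᵇ)

  ^-positive : ∀ {m} b → 1 ≤ m → 1 ≤ m ^ b
  ^-positive zero    _   = s≤s z≤n
  ^-positive (suc b) 1≤m = ℕₚ.*-mono-≤ 1≤m (^-positive b 1≤m)

  module _ {A : Set} (p : A → Bool) (D : A → ℕ) where

    count*min≤∑ : ∀ xs → ∑ xs (χ ∘ p) ≡ 0 ⊎ ∃ λ x → x ∈ xs × p x ≡ true × ∑ xs (χ ∘ p) * D x ≤ ∑ xs D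
    count*min≤∑ []       = inj₁ refl
    count*min≤∑ (y ∷ ys) with p y in py | count*min≤∑ ys
    ... | false | inj₁ none              = inj₁ none
    ... | false | inj₂ (x , x∈ , px , k) = inj₂ (x , there x∈ , px , ℕₚ.≤-trans k (ℕₚ.m≤n+m _ (D y)))
    ... | true  | inj₁ none              = inj₂ (y , here refl , py , ℕₚ.≤-trans (ℕₚ.≤-reflexive (cong (λ c → (1 + c) * D y) none))
                                                                              (ℕₚ.+-monoʳ-≤ (D y) z≤n))
    ... | true  | inj₂ (x , x∈ , px , k) with D y ℕ.≤? D x
    ...   | yes Dy≤Dx = inj₂ (y , here refl , py , ℕₚ.+-monoʳ-≤ (D y) (ℕₚ.≤-trans (ℕₚ.*-monoʳ-≤ (∑ ys (χ ∘ p)) Dy≤Dx) k))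
    ...   | no  Dy≰Dx = inj₂ (x , there x∈ , px , ℕₚ.+-mono-≤ (ℕₚ.<⇒≤ (ℕₚ.≰⇒> Dy≰Dx)) k)

    -- Markov's inequality with both sides raised to the power b, so that the threshold need not be an integer.
    markov-^ : ∀ xs b c e → 1 ≤ b → (∀ {x} → x ∈ xs → p x ≡ true → e ≤ D x ^ b * c) →
               ∑ xs (χ ∘ p) ^ b * e ≤ ∑ xs D ^ b * c
    markov-^ xs b c e 1≤b above with count*min≤∑ xs
    ... | inj₁ none = ℕₚ.≤-trans (ℕₚ.≤-reflexive (cong (λ k → k ^ b * e) none)) (0^b*e≤ 1≤b)
      where
      0^b*e≤ : 1 ≤ b → 0 ^ b * e ≤ ∑ xs D ^ b * c
      0^b*e≤ (s≤s _) = z≤n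
    ... | inj₂ (x , x∈xs , px , k) = begin
      count ^ b * e                ≤⟨ ℕₚ.*-monoʳ-≤ (count ^ b) (above x∈xs px) ⟩
      count ^ b * (D x ^ b * c)    ≡⟨ ℕₚ.*-assoc (count ^ b) _ c ⟨
      count ^ b * D x ^ b * c      ≡⟨ cong (_* c) (^-distribʳ-* count (D x) b) ⟨
      (count * D x) ^ b * c        ≤⟨ ℕₚ.*-monoˡ-≤ c (ℕₚ.^-monoˡ-≤ b k) ⟩
      ∑ xs D ^ b * c               ∎
      where
      open ℕₚ.≤-Reasoning
      count = ∑ xs (χ ∘ p)

  u*[u+d]^b≤ : ∀ u d b → u * (u + d) ^ b ≤ u * u ^ b + b * d * (u + d) ^ b
  u*[u+d]^b≤ u d zero    = ℕₚ.≤-reflexive (sym (ℕₚ.+-identityʳ _))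
  u*[u+d]^b≤ u d (suc b) = begin
    u * ((u + d) * (u + d) ^ b)
      ≡⟨ swap u d ((u + d) ^ b) ⟩
    (u + d) * (u * (u + d) ^ b)
      ≤⟨ ℕₚ.*-monoʳ-≤ (u + d) (u*[u+d]^b≤ u d b) ⟩
    (u + d) * (u * u ^ b + b * d * (u + d) ^ b)
      ≡⟨ expand u d (u ^ b) ((u + d) ^ b) b ⟩
    u * (u * u ^ b) + (d * (u * u ^ b) + b * d * ((u + d) * (u + d) ^ b))
      ≤⟨ ℕₚ.+-monoʳ-≤ (u * (u * u ^ b)) (ℕₚ.+-monoˡ-≤ _ (ℕₚ.*-monoʳ-≤ d (ℕₚ.^-monoˡ-≤ (suc b) (ℕₚ.m≤m+n u d)))) ⟩
    u * (u * u ^ b) + (d * (u + d) ^ suc b + b * d * (u + d) ^ suc b)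
      ≡⟨ cong (u * (u * u ^ b) +_) (collect d ((u + d) ^ suc b) b) ⟩
    u * (u * u ^ b) + suc b * d * (u + d) ^ suc b ∎
    where
    open ℕₚ.≤-Reasoning
    swap : ∀ u d X → u * ((u + d) * X) ≡ (u + d) * (u * X)
    swap = solve-∀
    expand : ∀ u d U X b → (u + d) * (u * U + b * d * X) ≡ u * (u * U) + (d * (u * U) + b * d * ((u + d) * X))
    expand = solve-∀
    collect : ∀ d Y b → d * Y + b * d * Y ≡ suc b * d * Y
    collect = solve-∀

  K*[u+d]^b≤[K+1]*u^b : ∀ K u d b → 1 ≤ u → d ≤ u → K * b * d * 2 ^ b ≤ u → K * (u + d) ^ b ≤ (K + 1) * u ^ b
  K*[u+d]^b≤[K+1]*u^b K u d b 1≤u d≤u u-large = ℕₚ.*-cancelˡ-≤ u {{>-nonZero 1≤u}} (begin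
    u * (K * (u + d) ^ b)
      ≡⟨ swap₁ u K _ ⟩
    K * (u * (u + d) ^ b)
      ≤⟨ ℕₚ.*-monoʳ-≤ K (u*[u+d]^b≤ u d b) ⟩
    K * (u * u ^ b + b * d * (u + d) ^ b)
      ≤⟨ ℕₚ.*-monoʳ-≤ K (ℕₚ.+-monoʳ-≤ (u * u ^ b) (ℕₚ.*-monoʳ-≤ (b * d) [u+d]^b≤2^b*u^b)) ⟩
    K * (u * u ^ b + b * d * (2 ^ b * u ^ b))
      ≡⟨ regroup K u (u ^ b) b d (2 ^ b) ⟩
    u * (K * u ^ b) + K * b * d * 2 ^ b * u ^ b
      ≤⟨ ℕₚ.+-monoʳ-≤ (u * (K * u ^ b)) (ℕₚ.*-monoˡ-≤ (u ^ b) u-large) ⟩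
    u * (K * u ^ b) + u * u ^ b
      ≡⟨ factor u K (u ^ b) ⟩
    u * ((K + 1) * u ^ b) ∎)
    where
    open ℕₚ.≤-Reasoning
    [u+d]^b≤2^b*u^b : (u + d) ^ b ≤ 2 ^ b * u ^ b
    [u+d]^b≤2^b*u^b = ℕₚ.≤-trans (ℕₚ.^-monoˡ-≤ b (ℕₚ.+-monoʳ-≤ u d≤u))
                                (ℕₚ.≤-reflexive (trans (cong (_^ b) (double u)) (^-distribʳ-* 2 u b)))
      where
      double : ∀ u → u + u ≡ 2 * u
      double = solve-∀
    swap₁ : ∀ u K X → u * (K * X) ≡ K * (u * X)
    swap₁ = solve-∀
    regroup : ∀ K u U b d T → K * (u * U + b * d * (T * U)) ≡ u * (K * U) + K * b * d * T * U
    regroup = solve-∀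
    factor : ∀ u K U → u * (K * U) + u * U ≡ u * ((K + 1) * U)
    factor = solve-∀

  n≤2*[n∸r] : ∀ {r n} → 2 * r ≤ n → n ≤ 2 * (n ∸ r)
  n≤2*[n∸r] {r} {n} 2r≤n = begin
    n                         ≡⟨ ℕₚ.m+[n∸m]≡n r≤n ⟨
    r + (n ∸ r)               ≤⟨ ℕₚ.+-monoˡ-≤ (n ∸ r) (ℕₚ.m+n≤o⇒m≤o∸n r (subst (_≤ n) (cong (r +_) (ℕₚ.+-identityʳ r)) 2r≤n)) ⟩
    (n ∸ r) + (n ∸ r)         ≡⟨ cong ((n ∸ r) +_) (ℕₚ.+-identityʳ (n ∸ r)) ⟨
    2 * (n ∸ r)               ∎
    where
    open ℕₚ.≤-Reasoning
    r≤n : r ≤ n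
    r≤n = ℕₚ.≤-trans (ℕₚ.m≤m+n r (r + 0)) 2r≤n

  -- (f/M)^b ≤ (1 + d/u)^b / A together with (k/g)^b < A gives f/M ≤ g/k once u is large.
  f*k≤M*g : ∀ {f M A u d g k} b → 1 ≤ b → 1 ≤ A → 1 ≤ u → d ≤ u → k ^ b * b * d * 2 ^ b ≤ u →
            k ^ b < A * g ^ b → f ^ b * A * u ^ b ≤ M ^ b * (u + d) ^ b → f * k ≤ M * g
  f*k≤M*g {f} {M} {A} {u} {d} {g} {k} b 1≤b 1≤A 1≤u d≤u u-large k^b<Ag^b few =
    ^-cancelˡ-≤ b 1≤b (ℕₚ.*-cancelʳ-≤ _ _ (A * u ^ b) {{>-nonZero (ℕₚ.*-mono-≤ 1≤A (^-positive b 1≤u))}} (begin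
      (f * k) ^ b * (A * u ^ b)
        ≡⟨ cong (_* (A * u ^ b)) (^-distribʳ-* f k b) ⟩
      f ^ b * k ^ b * (A * u ^ b)
        ≡⟨ shuffle (f ^ b) (k ^ b) A (u ^ b) ⟩
      k ^ b * (f ^ b * A * u ^ b)
        ≤⟨ ℕₚ.*-monoʳ-≤ (k ^ b) few ⟩
      k ^ b * (M ^ b * (u + d) ^ b)
        ≡⟨ swap (k ^ b) (M ^ b) _ ⟩
      M ^ b * (k ^ b * (u + d) ^ b)
        ≤⟨ ℕₚ.*-monoʳ-≤ (M ^ b) (K*[u+d]^b≤[K+1]*u^b (k ^ b) u d b 1≤u d≤u u-large) ⟩
      M ^ b * ((k ^ b + 1) * u ^ b)
        ≤⟨ ℕₚ.*-monoʳ-≤ (M ^ b) (ℕₚ.*-monoˡ-≤ (u ^ b) (ℕₚ.≤-trans (ℕₚ.≤-reflexive (ℕₚ.+-comm (k ^ b) 1)) k^b<Ag^b)) ⟩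
      M ^ b * (A * g ^ b * u ^ b)
        ≡⟨ regroup (M ^ b) A (g ^ b) (u ^ b) ⟩
      M ^ b * g ^ b * (A * u ^ b)
        ≡⟨ cong (_* (A * u ^ b)) (^-distribʳ-* M g b) ⟨
      (M * g) ^ b * (A * u ^ b) ∎))
    where
    open ℕₚ.≤-Reasoning
    shuffle : ∀ F K A U → F * K * (A * U) ≡ K * (F * A * U)
    shuffle = solve-∀
    swap : ∀ K N X → K * (N * X) ≡ N * (K * X)
    swap = solve-∀
    regroup : ∀ N A G U → N * (A * G * U) ≡ N * G * (A * U)
    regroup = solve-∀

  n<m^n : ∀ {m} n → 2 ≤ m → n < m ^ n
  n<m^n     zero    2≤m = s≤s z≤n
  n<m^n {m} (suc n) 2≤m = begin-strict
    suc n          ≤⟨ n<m^n n 2≤m ⟩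
    m ^ n          <⟨ ℕₚ.m<m+n (m ^ n) (^-positive n (ℕₚ.≤-trans (s≤s z≤n) 2≤m)) ⟩
    m ^ n + m ^ n  ≡⟨ cong (m ^ n +_) (ℕₚ.+-identityʳ (m ^ n)) ⟨
    2 * m ^ n      ≤⟨ ℕₚ.*-monoˡ-≤ (m ^ n) 2≤m ⟩
    m ^ suc n      ∎
    where open ℕₚ.≤-Reasoning

  x<q^[n∸r] : ∀ {q r n x} → 2 ≤ q → 2 * r ≤ n → 2 * x ≤ n → x < q ^ (n ∸ r)
  x<q^[n∸r] {q} {r} {n} {x} 2≤q 2r≤n 2x≤n =
    ℕₚ.≤-<-trans (ℕₚ.*-cancelˡ-≤ 2 (ℕₚ.≤-trans 2x≤n (n≤2*[n∸r] {r} 2r≤n)))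
                 (ℕₚ.<-≤-trans (n<m^n (n ∸ r) ℕₚ.≤-refl) (ℕₚ.^-monoˡ-≤ (n ∸ r) 2≤q))

module Fractions where

  open Powers using (^-positive)
  open import Data.Nat using (ℕ; zero; suc; _+_; _*_; _^_; _∸_; _≤_; _<_; z≤n; s≤s; >-nonZero)
  import Data.Nat.Properties as ℕₚ
  open import Data.Nat.Tactic.RingSolver using (solve-∀)
  open import Data.Integer as ℤ using (ℤ)
  import Data.Integer.Properties as ℤₚ
  open import Data.Integer.Tactic.RingSolver using () renaming (solve-∀ to ℤ-solve-∀)
  open import Data.Rational as ℚ using (ℚ; 0ℚ; 1ℚ; toℚᵘ)
  import Data.Rational.Properties as ℚₚ
  open import Data.Rational.Unnormalised as ℚᵘ using (mkℚᵘ) renaming (_≃_ to _≃ᵘ_)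
  import Data.Rational.Unnormalised.Properties as ℚᵘₚ
  open import Data.Bool using (true; false)
  open import Data.Bool.Properties using (T-≡)
  open import Function using (_∘_)
  open import Function.Bundles using (Equivalence)
  open import Relation.Nullary using (¬_)
  open import Relation.Binary.PropositionalEquality

  toℚᵘ-ratio : ∀ i k → toℚᵘ (ratio i (suc k)) ≃ᵘ mkℚᵘ i k
  toℚᵘ-ratio i k = ℚₚ.toℚᵘ-fromℚᵘ (mkℚᵘ i k)

  module _ {i j : ℤ} {k l : ℕ} where

    ratio-≤⁻ : 1 ≤ k → 1 ≤ l → ratio i k ℚ.≤ ratio j l → i ℤ.* ℤ.+ l ℤ.≤ j ℤ.* ℤ.+ k
    ratio-≤⁻ (s≤s _) (s≤s _) p≤q with ℚᵘₚ.≤-respʳ-≃ (toℚᵘ-ratio j _) (ℚᵘₚ.≤-respˡ-≃ (toℚᵘ-ratio i _) (ℚₚ.toℚᵘ-mono-≤ p≤q))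
    ... | ℚᵘ.*≤* cross = cross

    ratio-≤⁺ : 1 ≤ k → 1 ≤ l → i ℤ.* ℤ.+ l ℤ.≤ j ℤ.* ℤ.+ k → ratio i k ℚ.≤ ratio j l
    ratio-≤⁺ (s≤s _) (s≤s _) cross = ℚₚ.toℚᵘ-cancel-≤
      (ℚᵘₚ.≤-respʳ-≃ (ℚᵘₚ.≃-sym (toℚᵘ-ratio j _)) (ℚᵘₚ.≤-respˡ-≃ (ℚᵘₚ.≃-sym (toℚᵘ-ratio i _)) (ℚᵘ.*≤* cross)))

    ratio-<⁻ : 1 ≤ k → 1 ≤ l → ratio i k ℚ.< ratio j l → i ℤ.* ℤ.+ l ℤ.< j ℤ.* ℤ.+ k
    ratio-<⁻ (s≤s _) (s≤s _) p<q with ℚᵘₚ.<-respʳ-≃ (toℚᵘ-ratio j _) (ℚᵘₚ.<-respˡ-≃ (toℚᵘ-ratio i _) (ℚₚ.toℚᵘ-mono-< p<q))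
    ... | ℚᵘ.*<* cross = cross

    ratio-* : 1 ≤ k → 1 ≤ l → ratio i k ℚ.* ratio j l ≡ ratio (i ℤ.* j) (k * l)
    ratio-* (s≤s {n = k₀} _) (s≤s {n = l₀} _) = ℚₚ.toℚᵘ-injective (ℚᵘₚ.≃-trans (ℚₚ.toℚᵘ-homo-* (ratio i (suc k₀)) (ratio j (suc l₀)))
      (ℚᵘₚ.≃-trans (ℚᵘₚ.*-cong (toℚᵘ-ratio i k₀) (toℚᵘ-ratio j l₀)) (ℚᵘₚ.≃-sym (toℚᵘ-ratio (i ℤ.* j) _))))

  ratio-^ : ∀ i {k} b → 1 ≤ k → ratio i k ^ℚ b ≡ ratio (i ℤ.^ b) (k ^ b)
  ratio-^ i zero    1≤k = refl
  ratio-^ i {k} (suc b) 1≤k = trans (cong (ratio i k ℚ.*_) (ratio-^ i b 1≤k)) (ratio-* {i} {i ℤ.^ b} 1≤k (^-positive b 1≤k))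

  1-ratio : ∀ i k → 1ℚ ℚ.- ratio i (suc k) ≡ ratio (ℤ.+ suc k ℤ.- i) (suc k)
  1-ratio i k = ℚₚ.toℚᵘ-injective (ℚᵘₚ.≃-trans (ℚₚ.toℚᵘ-homo-+ 1ℚ (ℚ.- ratio i (suc k)))
    (ℚᵘₚ.≃-trans (ℚᵘₚ.+-congʳ (toℚᵘ 1ℚ) (ℚᵘₚ.≃-trans (ℚₚ.toℚᵘ-homo‿- (ratio i (suc k))) (ℚᵘₚ.-‿cong (toℚᵘ-ratio i k))))
      (ℚᵘₚ.≃-trans (ℚᵘ.*≡* (cross i (ℤ.+ suc k))) (ℚᵘₚ.≃-sym (toℚᵘ-ratio (ℤ.+ suc k ℤ.- i) k)))))
    where
    cross : ∀ i K → (ℤ.+ 1 ℤ.* K ℤ.+ ℤ.- i ℤ.* ℤ.+ 1) ℤ.* K ≡ (K ℤ.- i) ℤ.* (ℤ.+ 1 ℤ.* K)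
    cross = ℤ-solve-∀

  ratio-self : ∀ t → t ≡ ratio (ℚ.↥ t) (ℚ.↧ₙ t)
  ratio-self t@record{} = sym (ℚₚ.fromℚᵘ-toℚᵘ t)

  +-∸ : ∀ {m n} → n ≤ m → ℤ.+ m ℤ.- ℤ.+ n ≡ ℤ.+ (m ∸ n)
  +-∸ {m} {n} n≤m = trans (ℤₚ.m-n≡m⊖n m n) (ℤₚ.⊖-≥ n≤m)

  +-^ : ∀ m b → (ℤ.+ m) ℤ.^ b ≡ ℤ.+ (m ^ b)
  +-^ m zero    = refl
  +-^ m (suc b) = trans (cong (ℤ.+ m ℤ.*_) (+-^ m b)) (sym (ℤₚ.pos-* m (m ^ b)))

  module _ {m n k l : ℕ} (1≤k : 1 ≤ k) (1≤l : 1 ≤ l) where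

    ratio-ℕ-≤⁺ : m * l ≤ n * k → ratio (ℤ.+ m) k ℚ.≤ ratio (ℤ.+ n) l
    ratio-ℕ-≤⁺ ml≤nk = ratio-≤⁺ 1≤k 1≤l (subst₂ ℤ._≤_ (ℤₚ.pos-* m l) (ℤₚ.pos-* n k) (ℤ.+≤+ ml≤nk))

    ratio-ℕ-<⁻ : ratio (ℤ.+ m) k ℚ.< ratio (ℤ.+ n) l → m * l < n * k
    ratio-ℕ-<⁻ p<q = ℤₚ.drop‿+<+ (subst₂ ℤ._<_ (sym (ℤₚ.pos-* m l)) (sym (ℤₚ.pos-* n k)) (ratio-<⁻ 1≤k 1≤l p<q))

  0<ratio⇒nonNeg : ∀ {i k} → 1 ≤ k → 0ℚ ℚ.< ratio i k → ℤ.+ ℤ.∣ i ∣ ≡ i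
  0<ratio⇒nonNeg {i} {k} 1≤k 0<i/k = ℤₚ.0≤i⇒+∣i∣≡i (ℤₚ.<⇒≤ (subst (ℤ.0ℤ ℤ.<_) (ℤₚ.*-identityʳ i)
    (ratio-<⁻ {ℤ.0ℤ} {i} {1} {k} (s≤s z≤n) 1≤k 0<i/k)))

  bias≥1/Q : ∀ {c₀ c₁ P Q} → 1 ≤ P → 1 ≤ Q → Q * c₁ + P ≤ Q * c₀ → ratio (ℤ.+ 1) Q ℚ.≤ ratio (ℤ.+ c₀ ℤ.- ℤ.+ c₁) P
  bias≥1/Q {c₀} {c₁} {P} {Q} 1≤P 1≤Q Qc₁+P≤Qc₀ =
    subst (λ i → ratio (ℤ.+ 1) Q ℚ.≤ ratio i P) (sym (+-∸ c₁≤c₀)) (ratio-ℕ-≤⁺ 1≤Q 1≤P (begin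
      1 * P                 ≡⟨ ℕₚ.*-identityˡ P ⟩
      P                     ≡⟨ ℕₚ.m+n∸m≡n (Q * c₁) P ⟨
      Q * c₁ + P ∸ Q * c₁   ≤⟨ ℕₚ.∸-monoˡ-≤ (Q * c₁) Qc₁+P≤Qc₀ ⟩
      Q * c₀ ∸ Q * c₁       ≡⟨ ℕₚ.*-distribˡ-∸ Q c₀ c₁ ⟨
      Q * (c₀ ∸ c₁)         ≡⟨ ℕₚ.*-comm Q _ ⟩
      (c₀ ∸ c₁) * Q         ∎))
    where
    open ℕₚ.≤-Reasoning
    c₁≤c₀ : c₁ ≤ c₀
    c₁≤c₀ = ℕₚ.*-cancelˡ-≤ Q {{>-nonZero 1≤Q}} (ℕₚ.≤-trans (ℕₚ.m≤m+n (Q * c₁) P) Qc₁+P≤Qc₀)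

  bias^b>A/B : ∀ {c₀ c₁ P A B} b → c₁ ≤ c₀ → 1 ≤ P → 1 ≤ B →
               ¬ (ratio (ℤ.+ c₀ ℤ.- ℤ.+ c₁) P ^ℚ b ℚ.≤ ratio (ℤ.+ A) B) → A * P ^ b < (c₀ ∸ c₁) ^ b * B
  bias^b>A/B {c₀} {c₁} {P} {A} {B} b c₁≤c₀ 1≤P 1≤B bias^b≰ =
    ratio-ℕ-<⁻ 1≤B (^-positive b 1≤P) (ℚₚ.≰⇒> (bias^b≰ ∘ subst (ℚ._≤ ratio (ℤ.+ A) B) (sym bias^b)))
    where
    bias^b : ratio (ℤ.+ c₀ ℤ.- ℤ.+ c₁) P ^ℚ b ≡ ratio (ℤ.+ ((c₀ ∸ c₁) ^ b)) (P ^ b)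
    bias^b = trans (ratio-^ _ b 1≤P) (cong (λ i → ratio i (P ^ b)) (trans (cong (ℤ._^ b) (+-∸ c₁≤c₀)) (+-^ (c₀ ∸ c₁) b)))

  2r≤n : ∀ {ε r n} → 0ℚ ℚ.< ε → ratio (ℤ.+ r) 1 ℚ.≤ (1ℚ ℚ.- ε) ℚ.* ratio (ℤ.+ n) 2 → 2 * r ≤ n
  2r≤n {ε@record{}} {r} {n} 0<ε r≤[1-ε]n/2 = ℕₚ.*-cancelʳ-≤ (2 * r) n e₂ (begin
    2 * r * e₂                  ≡⟨ reorder r e₂ ⟩
    r * (e₂ * 2)                ≤⟨ ℕₚ.m≤m+n _ _ ⟩
    r * (e₂ * 2) + e₁ * n       ≤⟨ ℤₚ.drop‿+≤+ cross ⟩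
    e₂ * n                      ≡⟨ ℕₚ.*-comm e₂ n ⟩
    n * e₂                      ∎)
    where
    open ℕₚ.≤-Reasoning
    e₂ = ℚ.↧ₙ ε
    reorder : ∀ r e → 2 * r * e ≡ r * (e * 2)
    reorder = solve-∀
    e₁ : ℕ
    e₁ = ℤ.∣ ℚ.↥ ε ∣
    ↥ε≡e₁ : ℚ.↥ ε ≡ ℤ.+ e₁
    ↥ε≡e₁ = sym (0<ratio⇒nonNeg (s≤s z≤n) (subst (0ℚ ℚ.<_) (ratio-self ε) 0<ε))
    cross : ℤ.+ (r * (e₂ * 2) + e₁ * n) ℤ.≤ ℤ.+ (e₂ * n)
    cross = subst₂ ℤ._≤_
      (trans (cong₂ ℤ._+_ (sym (ℤₚ.pos-* r (e₂ * 2))) (sym (ℤₚ.pos-* e₁ n))) (sym (ℤₚ.pos-+ (r * (e₂ * 2)) (e₁ * n))))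
      (trans (cancel (ℤ.+ e₂) (ℤ.+ e₁) (ℤ.+ n)) (sym (ℤₚ.pos-* e₂ n)))
      (ℤₚ.+-monoˡ-≤ (ℤ.+ e₁ ℤ.* ℤ.+ n)
        (ratio-≤⁻ {ℤ.+ r} {(ℤ.+ e₂ ℤ.- ℤ.+ e₁) ℤ.* ℤ.+ n} {1} {e₂ * 2} (s≤s z≤n) (s≤s z≤n) r≤[1-ε]n/2′))
      where
      cancel : ∀ e₂ e₁ n → (e₂ ℤ.- e₁) ℤ.* n ℤ.* ℤ.+ 1 ℤ.+ e₁ ℤ.* n ≡ e₂ ℤ.* n
      cancel = ℤ-solve-∀
      [1-ε]n/2 : (1ℚ ℚ.- ε) ℚ.* ratio (ℤ.+ n) 2 ≡ ratio ((ℤ.+ e₂ ℤ.- ℤ.+ e₁) ℤ.* ℤ.+ n) (e₂ * 2)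
      [1-ε]n/2 = trans (cong (λ p → (1ℚ ℚ.- p) ℚ.* ratio (ℤ.+ n) 2) (trans (ratio-self ε) (cong (λ i → ratio i e₂) ↥ε≡e₁)))
                 (trans (cong (ℚ._* ratio (ℤ.+ n) 2) (1-ratio (ℤ.+ e₁) (ℚ.ℚ.denominator-1 ε)))
                        (ratio-* {ℤ.+ e₂ ℤ.- ℤ.+ e₁} {ℤ.+ n} {e₂} {2} (s≤s z≤n) (s≤s z≤n)))
      r≤[1-ε]n/2′ : ratio (ℤ.+ r) 1 ℚ.≤ ratio ((ℤ.+ e₂ ℤ.- ℤ.+ e₁) ℤ.* ℤ.+ n) (e₂ * 2)
      r≤[1-ε]n/2′ = subst (ratio (ℤ.+ r) 1 ℚ.≤_) [1-ε]n/2 r≤[1-ε]n/2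

  ≤⇒≤ᵇ≡true : ∀ {p q} → p ℚ.≤ q → (p ℚ.≤ᵇ q) ≡ true
  ≤⇒≤ᵇ≡true p≤q = Equivalence.to T-≡ (ℚₚ.≤⇒≤ᵇ p≤q)

  ≤ᵇ≡false⇒≰ : ∀ {p q} → (p ℚ.≤ᵇ q) ≡ false → ¬ p ℚ.≤ q
  ≤ᵇ≡false⇒≰ p≰ᵇq p≤q with () ← trans (sym (≤⇒≤ᵇ≡true p≤q)) p≰ᵇq

  -- The numerator of 1 - t over the denominator of t; only meaningful when t < 1.
  gap : ℚ → ℕ
  gap t = ℤ.∣ ℤ.+ ℚ.↧ₙ t ℤ.- ℚ.↥ t ∣

  1-t≡[↧t-↥t]/↧t : ∀ t → 1ℚ ℚ.- t ≡ ratio (ℤ.+ ℚ.↧ₙ t ℤ.- ℚ.↥ t) (ℚ.↧ₙ t)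
  1-t≡[↧t-↥t]/↧t t@record{} = trans (cong (λ p → 1ℚ ℚ.- p) (ratio-self t)) (1-ratio (ℚ.↥ t) (ℚ.ℚ.denominator-1 t))

  +gap≡↧t-↥t : ∀ t → 0ℚ ℚ.< 1ℚ ℚ.- t → ℤ.+ gap t ≡ ℤ.+ ℚ.↧ₙ t ℤ.- ℚ.↥ t
  +gap≡↧t-↥t t@record{} 0<1-t = 0<ratio⇒nonNeg (s≤s z≤n) (subst (0ℚ ℚ.<_) (1-t≡[↧t-↥t]/↧t t) 0<1-t)

  1-t≡gap/↧t : ∀ t → 0ℚ ℚ.< 1ℚ ℚ.- t → 1ℚ ℚ.- t ≡ ratio (ℤ.+ gap t) (ℚ.↧ₙ t)
  1-t≡gap/↧t t 0<1-t = trans (1-t≡[↧t-↥t]/↧t t) (cong (λ i → ratio i (ℚ.↧ₙ t)) (sym (+gap≡↧t-↥t t 0<1-t)))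

  ↧t^b<A*gap^b : ∀ t b {A} → 0ℚ ℚ.< 1ℚ ℚ.- t → 1 ≤ A → ratio (ℤ.+ 1) A ℚ.< (1ℚ ℚ.- t) ^ℚ b → ℚ.↧ₙ t ^ b < A * gap t ^ b
  ↧t^b<A*gap^b t@record{} b {A} 0<1-t 1≤A 1/A<[1-t]^b = subst₂ _<_ (ℕₚ.*-identityˡ _) (ℕₚ.*-comm (gap t ^ b) A)
    (ratio-ℕ-<⁻ {1} {gap t ^ b} {A} {ℚ.↧ₙ t ^ b} 1≤A (^-positive b (s≤s z≤n)) (subst (ratio (ℤ.+ 1) A ℚ.<_) [1-t]^b 1/A<[1-t]^b))
    where
    [1-t]^b : (1ℚ ℚ.- t) ^ℚ b ≡ ratio (ℤ.+ (gap t ^ b)) (ℚ.↧ₙ t ^ b)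
    [1-t]^b = trans (cong (_^ℚ b) (1-t≡gap/↧t t 0<1-t))
                    (trans (ratio-^ (ℤ.+ gap t) b (s≤s z≤n)) (cong (λ i → ratio i (ℚ.↧ₙ t ^ b)) (+-^ (gap t) b)))

  t≤c/M : ∀ t {c f M} → 0ℚ ℚ.< 1ℚ ℚ.- t → 1 ≤ M → c + f ≡ M → f * ℚ.↧ₙ t ≤ M * gap t → t ℚ.≤ ratio (ℤ.+ c) M
  t≤c/M t@record{} {c} {f} {M} 0<1-t 1≤M c+f≡M f*t↧≤M*gap =
    subst (ℚ._≤ ratio (ℤ.+ c) M) (sym (ratio-self t)) (ratio-≤⁺ {t↥} {ℤ.+ c} {t↧} {M} (s≤s z≤n) 1≤M (begin
      t↥ ℤ.* ℤ.+ M
        ≡⟨ cong (ℤ._* ℤ.+ M) t↥≡ ⟩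
      (ℤ.+ t↧ ℤ.- ℤ.+ gap t) ℤ.* ℤ.+ M
        ≡⟨ distrib (ℤ.+ t↧) (ℤ.+ gap t) (ℤ.+ M) ⟩
      ℤ.+ t↧ ℤ.* ℤ.+ M ℤ.- ℤ.+ gap t ℤ.* ℤ.+ M
        ≤⟨ ℤₚ.+-monoʳ-≤ (ℤ.+ t↧ ℤ.* ℤ.+ M) (ℤₚ.neg-mono-≤ f-bound) ⟩
      ℤ.+ t↧ ℤ.* ℤ.+ M ℤ.- ℤ.+ f ℤ.* ℤ.+ t↧
        ≡⟨ cong (λ m → ℤ.+ t↧ ℤ.* m ℤ.- ℤ.+ f ℤ.* ℤ.+ t↧) (trans (cong ℤ.+_ (sym c+f≡M)) (ℤₚ.pos-+ c f)) ⟩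
      ℤ.+ t↧ ℤ.* (ℤ.+ c ℤ.+ ℤ.+ f) ℤ.- ℤ.+ f ℤ.* ℤ.+ t↧
        ≡⟨ cancel (ℤ.+ t↧) (ℤ.+ c) (ℤ.+ f) ⟩
      ℤ.+ c ℤ.* ℤ.+ t↧ ∎))
    where
    open ℤₚ.≤-Reasoning
    t↥ = ℚ.↥ t
    t↧ = ℚ.↧ₙ t
    t↥≡ : t↥ ≡ ℤ.+ t↧ ℤ.- ℤ.+ gap t
    t↥≡ = trans (flip (ℤ.+ t↧) t↥) (cong (λ g → ℤ.+ t↧ ℤ.- g) (sym (+gap≡↧t-↥t t 0<1-t)))
      where
      flip : ∀ d n → n ≡ d ℤ.- (d ℤ.- n)
      flip = ℤ-solve-∀
    f-bound : ℤ.+ f ℤ.* ℤ.+ t↧ ℤ.≤ ℤ.+ gap t ℤ.* ℤ.+ M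
    f-bound = subst₂ ℤ._≤_ (ℤₚ.pos-* f t↧) (trans (ℤₚ.pos-* M (gap t)) (ℤₚ.*-comm (ℤ.+ M) _)) (ℤ.+≤+ f*t↧≤M*gap)
    distrib : ∀ d g m → (d ℤ.- g) ℤ.* m ≡ d ℤ.* m ℤ.- g ℤ.* m
    distrib = ℤ-solve-∀
    cancel : ∀ d c f → d ℤ.* (c ℤ.+ f) ℤ.- f ℤ.* d ≡ c ℤ.* d
    cancel = ℤ-solve-∀

module ReducibleForms (F : FiniteField) where

  open Sums
  open Powers
  open Fractions
  open import Data.Nat using (ℕ; zero; suc; _+_; _*_; _^_; _∸_; _≤_; _<_; z≤n; s≤s; NonZero; >-nonZero; >-nonZero⁻¹)
  import Data.Nat.Properties as ℕₚ
  open import Data.Nat.Tactic.RingSolver using (solve-∀)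
  import Data.Integer as ℤ
  open import Data.Rational as ℚ using (0ℚ; 1ℚ)
  open import Data.Bool using (Bool; true; false; not; _∧_; _∨_)
  open import Data.Bool.Properties using (∧-comm; ∧-assoc)
  open import Data.List using (List; []; _∷_; length; map; concatMap; allFin)
  import Data.List
  import Data.List.Properties as Listₚ
  import Data.Vec as Vec
  open import Data.Vec using (Vec; _[_]≔_) renaming ([] to []ᵥ; _∷_ to _∷ᵥ_)
  import Data.Vec.Properties as Vecₚ
  open import Data.Fin using (Fin; zero; suc)
  open import Data.Fin.Subset using (Subset; ∁; Nonempty) renaming (_∈_ to _∈ₛ_; _∉_ to _∉ₛ_)
  open import Data.Fin.Subset.Properties using (_∈?_; x∈p⇒x∉∁p; x∉p⇒x∈∁p)
  open import Data.List.Relation.Unary.All as All using (All; []; _∷_)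
  import Data.List.Relation.Unary.All.Properties as Allₚ
  open import Data.List.Relation.Unary.Any using (Any; here; there)
  import Data.List.Relation.Unary.Any.Properties as Anyₚ
  open import Data.List.Relation.Unary.Unique.Propositional using (Unique)
  import Data.List.Relation.Unary.Unique.Propositional.Properties as Uniqueₚ
  open import Data.List.Relation.Unary.AllPairs as AllPairs using ()
  open import Data.List.Membership.Propositional using (_∈_; _∉_; lose)
  import Data.List.Membership.Propositional.Properties as Membershipₚ
  open import Data.Empty using (⊥-elim)
  open import Data.Sum using (_⊎_; inj₁; inj₂)
  open import Data.Product using (∃; Σ; _×_; _,_; proj₁; proj₂)
  open import Level using (0ℓ)
  open import Algebra.Bundles using (CommutativeRing)
  open import Function using (_∘_)
  open import Relation.Nullary using (Dec; yes; no)
  open import Relation.Binary.PropositionalEquality hiding (J)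

  open FiniteField F renaming (_+_ to infixl 6 _+ᶠ_; _*_ to infixl 7 _*ᶠ_; -_ to infix 8 -ᶠ_)

  ring : CommutativeRing 0ℓ 0ℓ
  ring = record { isCommutativeRing = isCommutativeRing }

  open CommutativeRing ring
    using (+-assoc; *-assoc; *-comm; distribˡ; distribʳ; +-identityˡ; +-identityʳ;
           *-identityˡ; *-identityʳ; -‿inverseˡ; -‿inverseʳ; zeroʳ)
  open import Algebra.Properties.Ring (CommutativeRing.ring ring) using (+-identityˡ-unique; x+x≈x⇒x≈0)
  open import Algebra.Properties.CommutativeSemigroup (CommutativeRing.+-commutativeSemigroup ring)
    using () renaming (interchange to +ᶠ-interchange)

  q : ℕ
  q = order

  -- Counting over F and Fⁿ

  infix 4 _==_
  _==_ : Carrier → Carrier → Bool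
  _==_ = isᵇ F

  ==-refl : ∀ a → (a == a) ≡ true
  ==-refl a with a ≟ a
  ... | yes _ = refl
  ... | no a≢a = ⊥-elim (a≢a refl)

  ==⇒≡ : ∀ {a b} → (a == b) ≡ true → a ≡ b
  ==⇒≡ {a} {b} e with a ≟ b
  ... | yes a≡b = a≡b

  ≢⇒==-false : ∀ {a b} → a ≢ b → (a == b) ≡ false
  ≢⇒==-false {a} {b} a≢b with a ≟ b
  ... | yes a≡b = ⊥-elim (a≢b a≡b)
  ... | no _    = refl

  ==-sym : ∀ a b → (a == b) ≡ (b == a)
  ==-sym a b with a ≟ b | b ≟ a
  ... | yes _ | yes _ = refl
  ... | no _  | no _  = refl
  ... | yes p | no ¬p = ⊥-elim (¬p (sym p))
  ... | no ¬p | yes p = ⊥-elim (¬p (sym p))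

  ∑-select : ∀ w (h : Carrier → ℕ) → ∑[ y ← elements ] (χ (y == w) * h y) ≡ h w
  ∑-select w h = go elements elements-unique (elements-complete w)
    where
    absent : ∀ ys → All (w ≢_) ys → ∑[ y ← ys ] (χ (y == w) * h y) ≡ 0
    absent []       []         = refl
    absent (y ∷ ys) (w≢y ∷ ps) = cong₂ _+_ (cong (λ b → χ b * h y) (≢⇒==-false (w≢y ∘ sym))) (absent ys ps)
    go : ∀ ys → Unique ys → w ∈ ys → ∑[ y ← ys ] (χ (y == w) * h y) ≡ h w
    go (y ∷ ys) (ps AllPairs.∷ _) (here refl) =
      trans (cong₂ _+_ (cong (λ b → χ b * h w) (==-refl w)) (absent ys ps))
            (trans (ℕₚ.+-identityʳ _) (ℕₚ.+-identityʳ (h w)))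
    go (y ∷ ys) (ps AllPairs.∷ u) (there w∈ys) =
      cong₂ _+_ (cong (λ b → χ b * h y) (≢⇒==-false (λ y≡w → All.lookup ps w∈ys y≡w))) (go ys u w∈ys)

  ∑-χ-== : ∀ w → ∑[ y ← elements ] χ (y == w) ≡ 1
  ∑-χ-== w = trans (∑-cong elements (λ y → sym (ℕₚ.*-identityʳ (χ (y == w))))) (∑-select w (λ _ → 1))

  ∑-χ-==ʳ : ∀ w → ∑[ y ← elements ] χ (w == y) ≡ 1
  ∑-χ-==ʳ w = trans (∑-cong elements (λ y → cong χ (==-sym w y))) (∑-χ-== w)

  module _ (σ τ : Carrier → Carrier) (στ : ∀ y → σ (τ y) ≡ y) (τσ : ∀ c → τ (σ c) ≡ c) where

    ==-transpose : ∀ y c → (y == σ c) ≡ (c == τ y)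
    ==-transpose y c with y ≟ σ c | c ≟ τ y
    ... | yes _ | yes _ = refl
    ... | no _  | no _  = refl
    ... | yes p | no ¬p = ⊥-elim (¬p (trans (sym (τσ c)) (cong τ (sym p))))
    ... | no ¬p | yes p = ⊥-elim (¬p (trans (sym (στ y)) (cong σ (sym p))))

    ∑-bijection : ∀ (h : Carrier → ℕ) → ∑ elements (h ∘ σ) ≡ ∑ elements h
    ∑-bijection h = begin
      ∑[ c ← elements ] h (σ c)
        ≡⟨ ∑-cong elements (λ c → sym (∑-select (σ c) h)) ⟩
      ∑[ c ← elements ] ∑[ y ← elements ] (χ (y == σ c) * h y)
        ≡⟨ ∑-swap elements elements _ ⟩
      ∑[ y ← elements ] ∑[ c ← elements ] (χ (y == σ c) * h y)
        ≡⟨ ∑-cong elements (λ y → ∑-cong elements (λ c → cong (λ b → χ b * h y) (==-transpose y c))) ⟩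
      ∑[ y ← elements ] ∑[ c ← elements ] (χ (c == τ y) * h y)
        ≡⟨ ∑-cong elements (λ y → ∑-*ʳ elements (h y) _) ⟩
      ∑[ y ← elements ] (∑[ c ← elements ] χ (c == τ y) * h y)
        ≡⟨ ∑-cong elements (λ y → trans (cong (_* h y) (∑-χ-== (τ y))) (ℕₚ.*-identityˡ (h y))) ⟩
      ∑[ y ← elements ] h y ∎
      where open ≡-Reasoning

  2≤q : 2 ≤ q
  2≤q = begin
    2                                                         ≡⟨ cong₂ _+_ (sym (∑-χ-== 0#)) (sym (∑-χ-== 1#)) ⟩
    ∑[ y ← elements ] χ (y == 0#) + ∑[ y ← elements ] χ (y == 1#)   ≡⟨ ∑-+ elements _ _ ⟨
    ∑[ y ← elements ] (χ (y == 0#) + χ (y == 1#))             ≤⟨ ∑-mono elements at-most-one ⟩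
    ∑[ _ ← elements ] 1                                       ≡⟨ ∑-one elements ⟩
    q                                                         ∎
    where
    open ℕₚ.≤-Reasoning
    at-most-one : ∀ y → χ (y == 0#) + χ (y == 1#) ≤ 1
    at-most-one y with y ≟ 0# | y ≟ 1#
    ... | yes y≡0 | yes y≡1 = ⊥-elim (0≢1 (trans (sym y≡0) y≡1))
    ... | yes _   | no _    = s≤s z≤n
    ... | no _    | yes _   = s≤s z≤n
    ... | no _    | no _    = z≤n

  q^-nonZero : ∀ k → NonZero (q ^ k)
  q^-nonZero k = >-nonZero (ℕₚ.m^n>0 q {{>-nonZero (ℕₚ.<-≤-trans (s≤s z≤n) 2≤q)}} k)

  1≤q^ : ∀ k → 1 ≤ q ^ k
  1≤q^ k = >-nonZero⁻¹ (q ^ k) {{q^-nonZero k}}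

  _⁻¹ : ∀ x → x ≢ 0# → Carrier
  (x ⁻¹) x≢0 = proj₁ (inverse x x≢0)

  module _ (m : Carrier) (m≢0 : m ≢ 0#) (w : Carrier) where

    private
      m⁻¹ = (m ⁻¹) m≢0

      m⁻¹*m : m⁻¹ *ᶠ m ≡ 1#
      m⁻¹*m = trans (*-comm m⁻¹ m) (proj₂ (inverse m m≢0))

    affine affine⁻¹ : Carrier → Carrier
    affine   x = x *ᶠ m +ᶠ w
    affine⁻¹ y = (y +ᶠ -ᶠ w) *ᶠ m⁻¹

    affine∘affine⁻¹ : ∀ y → affine (affine⁻¹ y) ≡ y
    affine∘affine⁻¹ y = begin
      (y +ᶠ -ᶠ w) *ᶠ m⁻¹ *ᶠ m +ᶠ w    ≡⟨ cong (_+ᶠ w) (*-assoc _ m⁻¹ m) ⟩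
      (y +ᶠ -ᶠ w) *ᶠ (m⁻¹ *ᶠ m) +ᶠ w  ≡⟨ cong (λ z → (y +ᶠ -ᶠ w) *ᶠ z +ᶠ w) m⁻¹*m ⟩
      (y +ᶠ -ᶠ w) *ᶠ 1# +ᶠ w          ≡⟨ cong (_+ᶠ w) (*-identityʳ _) ⟩
      y +ᶠ -ᶠ w +ᶠ w                  ≡⟨ +-assoc y (-ᶠ w) w ⟩
      y +ᶠ (-ᶠ w +ᶠ w)                ≡⟨ cong (y +ᶠ_) (-‿inverseˡ w) ⟩
      y +ᶠ 0#                         ≡⟨ +-identityʳ y ⟩
      y                               ∎
      where open ≡-Reasoning

    affine⁻¹∘affine : ∀ x → affine⁻¹ (affine x) ≡ x
    affine⁻¹∘affine x = begin
      (x *ᶠ m +ᶠ w +ᶠ -ᶠ w) *ᶠ m⁻¹    ≡⟨ cong (_*ᶠ m⁻¹) (+-assoc (x *ᶠ m) w (-ᶠ w)) ⟩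
      (x *ᶠ m +ᶠ (w +ᶠ -ᶠ w)) *ᶠ m⁻¹  ≡⟨ cong (λ z → (x *ᶠ m +ᶠ z) *ᶠ m⁻¹) (-‿inverseʳ w) ⟩
      (x *ᶠ m +ᶠ 0#) *ᶠ m⁻¹           ≡⟨ cong (_*ᶠ m⁻¹) (+-identityʳ _) ⟩
      x *ᶠ m *ᶠ m⁻¹                   ≡⟨ *-assoc x m m⁻¹ ⟩
      x *ᶠ (m *ᶠ m⁻¹)                 ≡⟨ cong (x *ᶠ_) (proj₂ (inverse m m≢0)) ⟩
      x *ᶠ 1#                         ≡⟨ *-identityʳ x ⟩
      x                               ∎
      where open ≡-Reasoning

    affine-== : ∀ c z → (affine c == z) ≡ (c == affine⁻¹ z)
    affine-== c z = trans (==-sym (affine c) z) (==-transpose affine affine⁻¹ affine∘affine⁻¹ affine⁻¹∘affine z c)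

    ∑-χ-affine : ∀ z → ∑[ c ← elements ] χ (affine c == z) ≡ 1
    ∑-χ-affine z = trans (∑-cong elements (λ c → cong χ (affine-== c z))) (∑-χ-== (affine⁻¹ z))

  +ᶠ-==-cancelʳ : ∀ a z → ((a +ᶠ z) == z) ≡ (a == 0#)
  +ᶠ-==-cancelʳ a z with (a +ᶠ z) ≟ z | a ≟ 0#
  ... | yes _     | yes _   = refl
  ... | no _      | no _    = refl
  ... | yes a+z≡z | no a≢0  = ⊥-elim (a≢0 (+-identityˡ-unique a z a+z≡z))
  ... | no a+z≢z  | yes a≡0 = ⊥-elim (a+z≢z (trans (cong (_+ᶠ z) a≡0) (+-identityˡ z)))

  Vector : ℕ → Set
  Vector n = Vec Carrier n

  vectors : ∀ n → List (Vector n)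
  vectors n = allVecsOf elements n

  _⊕_ : ∀ {n} → Vector n → Vector n → Vector n
  _⊕_ = Vec.zipWith _+ᶠ_

  0ᵥ : ∀ {n} → Vector n
  0ᵥ {n} = Vec.replicate n 0#

  Additive : ∀ {n} → (Vector n → Carrier) → Set
  Additive g = ∀ u v → g (u ⊕ v) ≡ g u +ᶠ g v

  length-vectors : ∀ n → length (vectors n) ≡ q ^ n
  length-vectors n = length-allVecsOf elements n

  ∑-vectors-const : ∀ n c → ∑[ _ ← vectors n ] c ≡ q ^ n * c
  ∑-vectors-const n c = trans (∑-const (vectors n) c) (cong (_* c) (length-vectors n))

  ∑-translate : ∀ n (u : Vector n) (h : Vector n → ℕ) → ∑[ v ← vectors n ] h (v ⊕ u) ≡ ∑ (vectors n) h
  ∑-translate zero    []ᵥ        h = refl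
  ∑-translate (suc n) (u₀ ∷ᵥ u) h = begin
    ∑[ v ← vectors (suc n) ] h (v ⊕ (u₀ ∷ᵥ u))
      ≡⟨ ∑-allVecsOf-suc elements n _ ⟩
    ∑[ c ← elements ] ∑[ v ← vectors n ] h ((c +ᶠ u₀) ∷ᵥ (v ⊕ u))
      ≡⟨ ∑-cong elements (λ c → ∑-translate n u (λ v → h ((c +ᶠ u₀) ∷ᵥ v))) ⟩
    ∑[ c ← elements ] H (c +ᶠ u₀)
      ≡⟨ ∑-bijection (_+ᶠ u₀) (_+ᶠ (-ᶠ u₀)) (shift-back (-‿inverseˡ u₀)) (shift-back (-‿inverseʳ u₀)) H ⟩
    ∑[ c ← elements ] H c
      ≡⟨ ∑-allVecsOf-suc elements n h ⟨
    ∑[ v ← vectors (suc n) ] h v ∎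
    where
    open ≡-Reasoning
    H : Carrier → ℕ
    H c = ∑[ v ← vectors n ] h (c ∷ᵥ v)
    shift-back : ∀ {a b} → a +ᶠ b ≡ 0# → ∀ y → (y +ᶠ a) +ᶠ b ≡ y
    shift-back {a} {b} a+b≡0 y = trans (+-assoc y a b) (trans (cong (y +ᶠ_) a+b≡0) (+-identityʳ y))

  module _ {n} (P : Vector n → Bool) (P-closed : ∀ u → P u ≡ true → ∀ v → P (v ⊕ u) ≡ P v)
               (g : Vector n → Carrier) (g-additive : Additive g) where

    -- A nonempty level set of g inside P is a translate of the kernel of g inside P.
    count-level≤count-kernel : ∀ z → ∑[ v ← vectors n ] χ (P v ∧ (g v == z)) ≤ ∑[ v ← vectors n ] χ (P v ∧ (g v == 0#))
    count-level≤count-kernel z with ∑≡0⊎witness (vectors n) (λ v → χ (P v ∧ (g v == z)))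
    ... | inj₁ empty = ℕₚ.≤-trans (ℕₚ.≤-reflexive empty) z≤n
    ... | inj₂ (u , χu≢0) = ℕₚ.≤-reflexive (begin
      ∑[ v ← vectors n ] χ (P v ∧ (g v == z))
        ≡⟨ ∑-translate n u _ ⟨
      ∑[ v ← vectors n ] χ (P (v ⊕ u) ∧ (g (v ⊕ u) == z))
        ≡⟨ ∑-cong (vectors n) (λ v → cong₂ (λ a b → χ (a ∧ b)) (P-closed u Pu v) (shifted v)) ⟩
      ∑[ v ← vectors n ] χ (P v ∧ (g v == 0#)) ∎)
      where
      open ≡-Reasoning
      Pu∧gu≡z : P u ≡ true × (g u == z) ≡ true
      Pu∧gu≡z = ∧≡true⁻ (χ≢0⇒≡true χu≢0)
      Pu : P u ≡ true
      Pu = proj₁ Pu∧gu≡z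
      gu≡z : g u ≡ z
      gu≡z = ==⇒≡ (proj₂ Pu∧gu≡z)
      shifted : ∀ v → (g (v ⊕ u) == z) ≡ (g v == 0#)
      shifted v = trans (cong (_== z) (trans (g-additive v u) (cong (g v +ᶠ_) gu≡z))) (+ᶠ-==-cancelʳ (g v) z)

    count≤q*count-kernel : ∑ (vectors n) (χ ∘ P) ≤ q * ∑[ v ← vectors n ] χ (P v ∧ (g v == 0#))
    count≤q*count-kernel = begin
      ∑[ v ← vectors n ] χ (P v)                                     ≡⟨ ∑-cong (vectors n) split-by-value ⟩
      ∑[ v ← vectors n ] ∑[ z ← elements ] χ (P v ∧ (g v == z))     ≡⟨ ∑-swap (vectors n) elements _ ⟩
      ∑[ z ← elements ] ∑[ v ← vectors n ] χ (P v ∧ (g v == z))     ≤⟨ ∑-mono elements count-level≤count-kernel ⟩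
      ∑[ _ ← elements ] ∑[ v ← vectors n ] χ (P v ∧ (g v == 0#))    ≡⟨ ∑-const elements _ ⟩
      q * ∑[ v ← vectors n ] χ (P v ∧ (g v == 0#))                  ∎
      where
      open ℕₚ.≤-Reasoning
      split-by-value : ∀ v → χ (P v) ≡ ∑[ z ← elements ] χ (P v ∧ (g v == z))
      split-by-value v = sym (begin-equality
        ∑[ z ← elements ] χ (P v ∧ (g v == z))      ≡⟨ ∑-cong elements (λ z → χ-∧ (P v) _) ⟩
        ∑[ z ← elements ] (χ (P v) * χ (g v == z))  ≡⟨ ∑-*ˡ elements (χ (P v)) _ ⟩
        χ (P v) * ∑[ z ← elements ] χ (g v == z)    ≡⟨ cong (χ (P v) *_) (∑-χ-==ʳ (g v)) ⟩
        χ (P v) * 1                                 ≡⟨ ℕₚ.*-identityʳ _ ⟩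
        χ (P v)                                     ∎)

  allVanishᵇ : ∀ {A : Set} → List (A → Carrier) → A → Bool
  allVanishᵇ []       a = true
  allVanishᵇ (g ∷ gs) a = (g a == 0#) ∧ allVanishᵇ gs a

  allVanish-closed : ∀ {n} (gs : List (Vector n → Carrier)) → All Additive gs →
                     ∀ u → allVanishᵇ gs u ≡ true → ∀ v → allVanishᵇ gs (v ⊕ u) ≡ allVanishᵇ gs v
  allVanish-closed []       []                 u _   v = refl
  allVanish-closed (g ∷ gs) (g-add ∷ gs-add) u gsu v = cong₂ _∧_
    (cong (_== 0#) (trans (g-add v u) (trans (cong (g v +ᶠ_) (==⇒≡ (proj₁ (∧≡true⁻ gsu)))) (+-identityʳ (g v)))))
    (allVanish-closed gs gs-add u (proj₂ (∧≡true⁻ gsu)) v)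

  q^n≤q^k*countCommonKernel : ∀ n (gs : List (Vector n → Carrier)) → All Additive gs →
                             q ^ n ≤ q ^ length gs * ∑ (vectors n) (χ ∘ allVanishᵇ gs)
  q^n≤q^k*countCommonKernel n []       []               =
    ℕₚ.≤-reflexive (sym (trans (ℕₚ.+-identityʳ _) (trans (∑-one (vectors n)) (length-vectors n))))
  q^n≤q^k*countCommonKernel n (g ∷ gs) (g-add ∷ gs-add) = begin
    q ^ n
      ≤⟨ q^n≤q^k*countCommonKernel n gs gs-add ⟩
    q ^ length gs * ∑ (vectors n) (χ ∘ allVanishᵇ gs)
      ≤⟨ ℕₚ.*-monoʳ-≤ (q ^ length gs) (count≤q*count-kernel (allVanishᵇ gs) (allVanish-closed gs gs-add) g g-add) ⟩
    q ^ length gs * (q * ∑[ v ← vectors n ] χ (allVanishᵇ gs v ∧ (g v == 0#)))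
      ≡⟨ reassoc (q ^ length gs) q _ ⟩
    q ^ suc (length gs) * ∑[ v ← vectors n ] χ (allVanishᵇ gs v ∧ (g v == 0#))
      ≡⟨ cong (q ^ suc (length gs) *_) (∑-cong (vectors n) (λ v → cong χ (∧-comm (allVanishᵇ gs v) _))) ⟩
    q ^ suc (length gs) * ∑ (vectors n) (χ ∘ allVanishᵇ (g ∷ gs)) ∎
    where
    open ℕₚ.≤-Reasoning
    reassoc : ∀ a b c → a * (b * c) ≡ b * a * c
    reassoc = solve-∀

  -- Common zeros of multi-additive functions on (Fⁿ)ᵈ

  Proper : ∀ {d} → Subset d → Set
  Proper I = Nonempty I × Nonempty (∁ I)

  module _ (n : ℕ) where

    Pt : ℕ → Set
    Pt d = Point F d n

    0ₚ : ∀ {d} → Pt d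
    0ₚ {d} = Vec.replicate d 0ᵥ

    length-allPoints : ∀ d → length (allPoints F d n) ≡ (q ^ n) ^ d
    length-allPoints d = trans (length-allVecsOf (vectors n) d) (cong (_^ d) (length-vectors n))

    AdditiveIn : ∀ {d} → Fin d → (Pt d → Carrier) → Set
    AdditiveIn j g = ∀ x u v → g (x [ j ]≔ (u ⊕ v)) ≡ g (x [ j ]≔ u) +ᶠ g (x [ j ]≔ v)

    IndependentOf : ∀ {d} → Fin d → (Pt d → Carrier) → Set
    IndependentOf j g = ∀ x u → g (x [ j ]≔ u) ≡ g x

    -- The value at the origin matters only once no variables are left.
    MultiAdditive : ∀ {d} → (Pt d → Carrier) → Set
    MultiAdditive g = (∀ j → AdditiveIn j g ⊎ IndependentOf j g) × g 0ₚ ≡ 0#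

    MultiAdditives : ℕ → Set
    MultiAdditives d = List (Σ (Pt d → Carrier) MultiAdditive)

    restrict₀ : ∀ {d} → (Pt (suc d) → Carrier) → Pt d → Carrier
    restrict₀ g rest = g (0ᵥ ∷ᵥ rest)

    restrict₀-multiAdditive : ∀ {d} (g : Pt (suc d) → Carrier) → MultiAdditive g → MultiAdditive (restrict₀ g)
    restrict₀-multiAdditive g (slots , g0≡0) = (λ j → restrict-slot (slots (suc j))) , g0≡0
      where
      restrict-slot : ∀ {j} → AdditiveIn (suc j) g ⊎ IndependentOf (suc j) g →
                      AdditiveIn j (restrict₀ g) ⊎ IndependentOf j (restrict₀ g)
      restrict-slot (inj₁ add)   = inj₁ (λ x → add (0ᵥ ∷ᵥ x))
      restrict-slot (inj₂ indep) = inj₂ (λ x → indep (0ᵥ ∷ᵥ x))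

    Slot₀Additives : ℕ → Set
    Slot₀Additives d = List (Σ (Pt (suc d) → Carrier) (AdditiveIn zero))

    partition₀ : ∀ {d} → MultiAdditives (suc d) → Slot₀Additives d × MultiAdditives d
    partition₀ []                 = [] , []
    partition₀ ((g , mg) ∷ gs) with proj₁ mg zero | partition₀ gs
    ... | inj₁ add | as , bs = (g , add) ∷ as , bs
    ... | inj₂ _   | as , bs = as , (restrict₀ g , restrict₀-multiAdditive g mg) ∷ bs

    length-partition₀ : ∀ {d} (gs : MultiAdditives (suc d)) →
                        length (proj₁ (partition₀ gs)) + length (proj₂ (partition₀ gs)) ≡ length gs
    length-partition₀ []              = refl
    length-partition₀ ((g , mg) ∷ gs) with proj₁ mg zero
    ... | inj₁ _ = cong suc (length-partition₀ gs)
    ... | inj₂ _ = trans (ℕₚ.+-suc _ _) (cong suc (length-partition₀ gs))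

    allVanish-partition₀ : ∀ {d} (gs : MultiAdditives (suc d)) x₀ rest →
      allVanishᵇ (map proj₁ gs) (x₀ ∷ᵥ rest) ≡
      allVanishᵇ (map proj₁ (proj₁ (partition₀ gs))) (x₀ ∷ᵥ rest) ∧ allVanishᵇ (map proj₁ (proj₂ (partition₀ gs))) rest
    allVanish-partition₀ []              x₀ rest = refl
    allVanish-partition₀ ((g , mg) ∷ gs) x₀ rest with proj₁ mg zero
    ... | inj₁ _     = trans (cong ((g (x₀ ∷ᵥ rest) == 0#) ∧_) (allVanish-partition₀ gs x₀ rest))
                             (sym (∧-assoc (g (x₀ ∷ᵥ rest) == 0#) A B))
      where
      A = allVanishᵇ (map proj₁ (proj₁ (partition₀ gs))) (x₀ ∷ᵥ rest)
      B = allVanishᵇ (map proj₁ (proj₂ (partition₀ gs))) rest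
    ... | inj₂ indep = trans (cong₂ _∧_ (cong (_== 0#) (indep (0ᵥ ∷ᵥ rest) x₀)) (allVanish-partition₀ gs x₀ rest))
                             (∧-swap₁₂ (restrict₀ g rest == 0#) A B)
      where
      A = allVanishᵇ (map proj₁ (proj₁ (partition₀ gs))) (x₀ ∷ᵥ rest)
      B = allVanishᵇ (map proj₁ (proj₂ (partition₀ gs))) rest
      ∧-swap₁₂ : ∀ a b c → a ∧ (b ∧ c) ≡ b ∧ (a ∧ c)
      ∧-swap₁₂ a b c = trans (sym (∧-assoc a b c)) (trans (cong (_∧ c) (∧-comm a b)) (∧-assoc b a c))

    slices₀ : ∀ {d} → Slot₀Additives d → Pt d → List (Vector n → Carrier)
    slices₀ as rest = map (λ a x₀ → proj₁ a (x₀ ∷ᵥ rest)) as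

    slices₀-additive : ∀ {d} (as : Slot₀Additives d) rest → All Additive (slices₀ as rest)
    slices₀-additive []       rest = []
    slices₀-additive (a ∷ as) rest = proj₂ a (0ᵥ ∷ᵥ rest) ∷ slices₀-additive as rest

    allVanish-slices₀ : ∀ {d} (as : Slot₀Additives d) rest x₀ →
                        allVanishᵇ (slices₀ as rest) x₀ ≡ allVanishᵇ (map proj₁ as) (x₀ ∷ᵥ rest)
    allVanish-slices₀ []       rest x₀ = refl
    allVanish-slices₀ (a ∷ as) rest x₀ = cong (_ ∧_) (allVanish-slices₀ as rest x₀)

    q^n≤q^k*countSlice : ∀ {d} (as : Slot₀Additives d) rest →
                         q ^ n ≤ q ^ length as * ∑ (vectors n) (χ ∘ allVanishᵇ (slices₀ as rest))
    q^n≤q^k*countSlice as rest = subst (λ k → q ^ n ≤ q ^ k * ∑ (vectors n) (χ ∘ allVanishᵇ (slices₀ as rest)))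
                                       (Listₚ.length-map _ as)
                                       (q^n≤q^k*countCommonKernel n (slices₀ as rest) (slices₀-additive as rest))

    countCommonZeros : ∀ {d} → List (Pt d → Carrier) → ℕ
    countCommonZeros {d} gs = ∑ (allPoints F d n) (χ ∘ allVanishᵇ gs)

    countCommonZeros-partition₀ : ∀ {d} (gs : MultiAdditives (suc d)) →
      let (as , bs) = partition₀ gs in
      countCommonZeros (map proj₁ gs) ≡
      ∑[ rest ← allPoints F d n ] (∑ (vectors n) (χ ∘ allVanishᵇ (slices₀ as rest)) * χ (allVanishᵇ (map proj₁ bs) rest))
    countCommonZeros-partition₀ {d} gs = begin
      ∑ (allPoints F (suc d) n) (χ ∘ allVanishᵇ (map proj₁ gs))
        ≡⟨ ∑-allVecsOf-suc (vectors n) d _ ⟩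
      ∑[ x₀ ← vectors n ] ∑[ rest ← allPoints F d n ] χ (allVanishᵇ (map proj₁ gs) (x₀ ∷ᵥ rest))
        ≡⟨ ∑-cong (vectors n) (λ x₀ → ∑-cong (allPoints F d n) (λ rest → cong χ (allVanish-partition₀ gs x₀ rest))) ⟩
      ∑[ x₀ ← vectors n ] ∑[ rest ← allPoints F d n ] χ (A x₀ rest ∧ B rest)
        ≡⟨ ∑-cong (vectors n) (λ x₀ → ∑-cong (allPoints F d n) (λ rest → χ-∧ (A x₀ rest) (B rest))) ⟩
      ∑[ x₀ ← vectors n ] ∑[ rest ← allPoints F d n ] (χ (A x₀ rest) * χ (B rest))
        ≡⟨ ∑-swap (vectors n) (allPoints F d n) _ ⟩
      ∑[ rest ← allPoints F d n ] ∑[ x₀ ← vectors n ] (χ (A x₀ rest) * χ (B rest))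
        ≡⟨ ∑-cong (allPoints F d n) (λ rest → ∑-*ʳ (vectors n) (χ (B rest)) _) ⟩
      ∑[ rest ← allPoints F d n ] (∑[ x₀ ← vectors n ] χ (A x₀ rest) * χ (B rest))
        ≡⟨ ∑-cong (allPoints F d n) (λ rest → cong (_* χ (B rest))
             (∑-cong (vectors n) (λ x₀ → cong χ (sym (allVanish-slices₀ as rest x₀))))) ⟩
      ∑[ rest ← allPoints F d n ] (∑ (vectors n) (χ ∘ allVanishᵇ (slices₀ as rest)) * χ (B rest)) ∎
      where
      open ≡-Reasoning
      as = proj₁ (partition₀ gs)
      bs = proj₂ (partition₀ gs)
      A : Vector n → Pt d → Bool
      A x₀ rest = allVanishᵇ (map proj₁ as) (x₀ ∷ᵥ rest)
      B : Pt d → Bool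
      B = allVanishᵇ (map proj₁ bs)

    q^nd≤q^k*countCommonZeros : ∀ d (gs : MultiAdditives d) →
                                (q ^ n) ^ d ≤ q ^ length gs * countCommonZeros (map proj₁ gs)
    q^nd≤q^k*countCommonZeros zero    gs = ℕₚ.≤-trans (1≤q^ (length gs))
      (ℕₚ.≤-reflexive (sym (trans (cong (λ b → q ^ length gs * (χ b + 0)) (allVanish-origin gs)) (ℕₚ.*-identityʳ _))))
      where
      allVanish-origin : ∀ (gs : MultiAdditives zero) → allVanishᵇ (map proj₁ gs) []ᵥ ≡ true
      allVanish-origin []                       = refl
      allVanish-origin ((g , (_ , g0≡0)) ∷ gs) = cong₂ _∧_ (trans (cong (_== 0#) g0≡0) (==-refl 0#)) (allVanish-origin gs)
    q^nd≤q^k*countCommonZeros (suc d) gs = begin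
      q ^ n * (q ^ n) ^ d
        ≤⟨ ℕₚ.*-monoʳ-≤ (q ^ n) (q^nd≤q^k*countCommonZeros d bs) ⟩
      q ^ n * (q ^ length bs * ∑ (allPoints F d n) (χ ∘ B))
        ≡⟨ swap (q ^ n) (q ^ length bs) _ ⟩
      q ^ length bs * (q ^ n * ∑ (allPoints F d n) (χ ∘ B))
        ≡⟨ cong (q ^ length bs *_) (∑-*ˡ (allPoints F d n) (q ^ n) _) ⟨
      q ^ length bs * ∑[ rest ← allPoints F d n ] (q ^ n * χ (B rest))
        ≤⟨ ℕₚ.*-monoʳ-≤ (q ^ length bs) (∑-mono (allPoints F d n) (λ rest → ℕₚ.*-monoˡ-≤ (χ (B rest)) (q^n≤q^k*countSlice as rest))) ⟩
      q ^ length bs * ∑[ rest ← allPoints F d n ] (q ^ length as * ZA rest * χ (B rest))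
        ≡⟨ cong (q ^ length bs *_) (trans (∑-cong (allPoints F d n) (λ rest → ℕₚ.*-assoc (q ^ length as) _ _))
                                           (∑-*ˡ (allPoints F d n) (q ^ length as) (λ rest → ZA rest * χ (B rest)))) ⟩
      q ^ length bs * (q ^ length as * ∑[ rest ← allPoints F d n ] (ZA rest * χ (B rest)))
        ≡⟨ ℕₚ.*-assoc (q ^ length bs) _ _ ⟨
      q ^ length bs * q ^ length as * ∑[ rest ← allPoints F d n ] (ZA rest * χ (B rest))
        ≡⟨ cong₂ _*_ q^|gs| (sym (countCommonZeros-partition₀ gs)) ⟩
      q ^ length gs * countCommonZeros (map proj₁ gs) ∎
      where
      open ℕₚ.≤-Reasoning
      as = proj₁ (partition₀ gs)
      bs = proj₂ (partition₀ gs)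
      B : Pt d → Bool
      B = allVanishᵇ (map proj₁ bs)
      ZA : Pt d → ℕ
      ZA rest = ∑ (vectors n) (χ ∘ allVanishᵇ (slices₀ as rest))
      swap : ∀ a b c → a * (b * c) ≡ b * (a * c)
      swap = solve-∀
      q^|gs| : q ^ length bs * q ^ length as ≡ q ^ length gs
      q^|gs| = trans (sym (ℕₚ.^-distribˡ-+-* q (length bs) (length as)))
                     (cong (q ^_) (trans (ℕₚ.+-comm (length bs) (length as)) (length-partition₀ gs)))

    module _ {d : ℕ} where

      monomial-independentOf : ∀ (J : List (Fin d)) k j → j ∉ J → IndependentOf j (monomial F J k)
      monomial-independentOf []      []ᵥ         j j∉J x u = refl
      monomial-independentOf (i ∷ J) (kᵢ ∷ᵥ ks) j j∉J x u =
        cong₂ _*ᶠ_ (cong (λ v → Vec.lookup v kᵢ) (Vecₚ.lookup∘update′ (λ i≡j → j∉J (here (sym i≡j))) x u))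
                   (monomial-independentOf J ks j (j∉J ∘ there) x u)

      monomial-additiveIn : ∀ (J : List (Fin d)) k j → Unique J → j ∈ J → AdditiveIn j (monomial F J k)
      monomial-additiveIn (j ∷ J) (kⱼ ∷ᵥ ks) j (j∉J AllPairs.∷ _) (here refl) x u v = begin
        entry (u ⊕ v) j *ᶠ M (x [ j ]≔ (u ⊕ v))
          ≡⟨ cong₂ _*ᶠ_ (updated (u ⊕ v)) (M-indep x (u ⊕ v)) ⟩
        Vec.lookup (u ⊕ v) kⱼ *ᶠ M x
          ≡⟨ cong (_*ᶠ M x) (Vecₚ.lookup-zipWith _+ᶠ_ kⱼ u v) ⟩
        (Vec.lookup u kⱼ +ᶠ Vec.lookup v kⱼ) *ᶠ M x
          ≡⟨ distribʳ (M x) _ _ ⟩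
        Vec.lookup u kⱼ *ᶠ M x +ᶠ Vec.lookup v kⱼ *ᶠ M x
          ≡⟨ sym (cong₂ _+ᶠ_ (cong₂ _*ᶠ_ (updated u) (M-indep x u)) (cong₂ _*ᶠ_ (updated v) (M-indep x v))) ⟩
        entry u j *ᶠ M (x [ j ]≔ u) +ᶠ entry v j *ᶠ M (x [ j ]≔ v) ∎
        where
        open ≡-Reasoning
        M = monomial F J ks
        entry : Vector n → Fin d → Carrier
        entry w i = Vec.lookup (Vec.lookup (x [ j ]≔ w) i) kⱼ
        updated : ∀ w → entry w j ≡ Vec.lookup w kⱼ
        updated w = cong (λ y → Vec.lookup y kⱼ) (Vecₚ.lookup∘update j x w)
        M-indep : IndependentOf j M
        M-indep = monomial-independentOf J ks j (λ j∈J → All.lookup j∉J j∈J refl)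
      monomial-additiveIn (i ∷ J) (kᵢ ∷ᵥ ks) j (i∉J AllPairs.∷ J-unique) (there j∈J) x u v = begin
        entry (u ⊕ v) *ᶠ M (x [ j ]≔ (u ⊕ v))
          ≡⟨ cong₂ _*ᶠ_ (untouched (u ⊕ v)) (monomial-additiveIn J ks j J-unique j∈J x u v) ⟩
        xᵢ *ᶠ (M (x [ j ]≔ u) +ᶠ M (x [ j ]≔ v))
          ≡⟨ distribˡ xᵢ _ _ ⟩
        xᵢ *ᶠ M (x [ j ]≔ u) +ᶠ xᵢ *ᶠ M (x [ j ]≔ v)
          ≡⟨ sym (cong₂ _+ᶠ_ (cong (_*ᶠ M (x [ j ]≔ u)) (untouched u)) (cong (_*ᶠ M (x [ j ]≔ v)) (untouched v))) ⟩
        entry u *ᶠ M (x [ j ]≔ u) +ᶠ entry v *ᶠ M (x [ j ]≔ v) ∎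
        where
        open ≡-Reasoning
        M = monomial F J ks
        xᵢ = Vec.lookup (Vec.lookup x i) kᵢ
        entry : Vector n → Carrier
        entry w = Vec.lookup (Vec.lookup (x [ j ]≔ w) i) kᵢ
        untouched : ∀ w → entry w ≡ xᵢ
        untouched w = cong (λ y → Vec.lookup y kᵢ) (Vecₚ.lookup∘update′ (All.lookup i∉J j∈J) x w)

      module _ {K : Set} (f : K → Pt d → Carrier) (j : Fin d) where

        combination : List Carrier → List K → Pt d → Carrier
        combination cs ks x = sumF F (Data.List.zipWith (λ c k → c *ᶠ f k x) cs ks)

        combination-independentOf : (∀ k → IndependentOf j (f k)) → ∀ cs ks → IndependentOf j (combination cs ks)
        combination-independentOf f-indep []       ks       x u = refl
        combination-independentOf f-indep (c ∷ cs) []       x u = refl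
        combination-independentOf f-indep (c ∷ cs) (k ∷ ks) x u =
          cong₂ _+ᶠ_ (cong (c *ᶠ_) (f-indep k x u)) (combination-independentOf f-indep cs ks x u)

        combination-additiveIn : (∀ k → AdditiveIn j (f k)) → ∀ cs ks → AdditiveIn j (combination cs ks)
        combination-additiveIn f-add []       ks       x u v = sym (+-identityʳ 0#)
        combination-additiveIn f-add (c ∷ cs) []       x u v = sym (+-identityʳ 0#)
        combination-additiveIn f-add (c ∷ cs) (k ∷ ks) x u v =
          trans (cong₂ _+ᶠ_ (trans (cong (c *ᶠ_) (f-add k x u v)) (distribˡ c _ _)) (combination-additiveIn f-add cs ks x u v))
                (+ᶠ-interchange _ _ _ _)

      vars-unique : ∀ (I : Subset d) → Unique (vars F I)
      vars-unique I = Uniqueₚ.filter⁺ (_∈? I) (Uniqueₚ.allFin⁺ d)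

      ∈⇒∈-vars : ∀ (I : Subset d) {j} → j ∈ₛ I → j ∈ vars F I
      ∈⇒∈-vars I {j} j∈I = Membershipₚ.∈-filter⁺ (_∈? I) (Membershipₚ.∈-allFin j) j∈I

      ∉⇒∉-vars : ∀ (I : Subset d) {j} → j ∉ₛ I → j ∉ vars F I
      ∉⇒∉-vars I j∉I j∈vars = j∉I (proj₂ (Membershipₚ.∈-filter⁻ (_∈? I) {xs = allFin d} j∈vars))

      formOf-additiveIn : ∀ (I : Subset d) cs {j} → j ∈ₛ I → AdditiveIn j (formOf F (vars F I) cs)
      formOf-additiveIn I cs {j} j∈I =
        combination-additiveIn (monomial F (vars F I)) j
          (λ k → monomial-additiveIn (vars F I) k j (vars-unique I) (∈⇒∈-vars I j∈I)) cs _

      formOf-independentOf : ∀ (I : Subset d) cs {j} → j ∉ₛ I → IndependentOf j (formOf F (vars F I) cs)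
      formOf-independentOf I cs {j} j∉I =
        combination-independentOf (monomial F (vars F I)) j (λ k → monomial-independentOf (vars F I) k j (∉⇒∉-vars I j∉I)) cs _

      additiveIn⇒origin-zero : ∀ j (g : Pt d → Carrier) → AdditiveIn j g → g 0ₚ ≡ 0#
      additiveIn⇒origin-zero j g g-add = x+x≈x⇒x≈0 (g 0ₚ) (begin
        g 0ₚ +ᶠ g 0ₚ
          ≡⟨ cong (λ y → g y +ᶠ g y) origin ⟨
        g (0ₚ [ j ]≔ 0ᵥ) +ᶠ g (0ₚ [ j ]≔ 0ᵥ)
          ≡⟨ g-add 0ₚ 0ᵥ 0ᵥ ⟨
        g (0ₚ [ j ]≔ (0ᵥ ⊕ 0ᵥ))
          ≡⟨ cong (λ w → g (0ₚ [ j ]≔ w)) (trans (Vecₚ.zipWith-replicate _+ᶠ_ 0# 0#) (cong (Vec.replicate n) (+-identityʳ 0#))) ⟩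
        g (0ₚ [ j ]≔ 0ᵥ)
          ≡⟨ cong g origin ⟩
        g 0ₚ ∎)
        where
        open ≡-Reasoning
        origin : 0ₚ [ j ]≔ 0ᵥ ≡ 0ₚ
        origin = trans (cong (0ₚ [ j ]≔_) (sym (Vecₚ.lookup-replicate j 0ᵥ))) (Vecₚ.[]≔-lookup 0ₚ j)

      formOf-multiAdditive : ∀ (I : Subset d) cs → Nonempty I → MultiAdditive (formOf F (vars F I) cs)
      formOf-multiAdditive I cs (j , j∈I) = slot , additiveIn⇒origin-zero j (formOf F (vars F I) cs) (formOf-additiveIn I cs j∈I)
        where
        slot : ∀ i → AdditiveIn i (formOf F (vars F I) cs) ⊎ IndependentOf i (formOf F (vars F I) cs)
        slot i with i ∈? I
        ... | yes i∈I = inj₁ (formOf-additiveIn I cs i∈I)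
        ... | no  i∉I = inj₂ (formOf-independentOf I cs i∉I)

    -- The bound ark(T) ≤ r

    -- T = Σᵢ Sᵢ Rᵢ seen from x₀; the cofactors are the factors of the terms that do not involve x₀.
    record Structured {d} (r : ℕ) (T : Pt (suc d) → Carrier) : Set where
      field
        cofactors        : MultiAdditives d
        length-cofactors : length cofactors ≡ r
        additive₀        : AdditiveIn zero T
        vanishes         : ∀ rest → allVanishᵇ (map proj₁ cofactors) rest ≡ true → ∀ x₀ → T (x₀ ∷ᵥ rest) ≡ 0#

    structured-zero : ∀ {d} → Structured 0 (λ (_ : Pt (suc d)) → 0#)
    structured-zero = record
      { cofactors = [] ; length-cofactors = refl
      ; additive₀ = λ _ _ _ → sym (+-identityʳ 0#) ; vanishes = λ _ _ _ → refl }

    structured-resp : ∀ {d r} {T T′ : Pt (suc d) → Carrier} → (∀ x → T x ≡ T′ x) → Structured r T → Structured r T′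
    structured-resp {T = T} {T′} T≗T′ s = record
      { cofactors = cofactors ; length-cofactors = length-cofactors
      ; additive₀ = λ x u v → trans (sym (T≗T′ _)) (trans (additive₀ x u v) (cong₂ _+ᶠ_ (T≗T′ _) (T≗T′ _)))
      ; vanishes  = λ rest v x₀ → trans (sym (T≗T′ _)) (vanishes rest v x₀) }
      where open Structured s

    structured-step : ∀ {d r} (A B T : Pt (suc d) → Carrier) →
                      AdditiveIn zero A → IndependentOf zero B → MultiAdditive B →
                      Structured r T → Structured (suc r) (λ x → A x *ᶠ B x +ᶠ T x)
    structured-step A B T A-add B-indep B-multi s = record
      { cofactors        = (restrict₀ B , restrict₀-multiAdditive B B-multi) ∷ cofactors
      ; length-cofactors = cong suc length-cofactors
      ; additive₀        = additive
      ; vanishes         = vanish }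
      where
      open Structured s
      additive : AdditiveIn zero (λ x → A x *ᶠ B x +ᶠ T x)
      additive (x₀ ∷ᵥ rest) u v = begin
        A (u ⊕ v ∷ᵥ rest) *ᶠ B (u ⊕ v ∷ᵥ rest) +ᶠ T (u ⊕ v ∷ᵥ rest)
          ≡⟨ cong₂ _+ᶠ_ (cong₂ _*ᶠ_ (A-add (x₀ ∷ᵥ rest) u v) (B-indep (x₀ ∷ᵥ rest) (u ⊕ v))) (additive₀ (x₀ ∷ᵥ rest) u v) ⟩
        (A (u ∷ᵥ rest) +ᶠ A (v ∷ᵥ rest)) *ᶠ b +ᶠ (T (u ∷ᵥ rest) +ᶠ T (v ∷ᵥ rest))
          ≡⟨ cong (_+ᶠ (T (u ∷ᵥ rest) +ᶠ T (v ∷ᵥ rest))) (distribʳ b _ _) ⟩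
        (A (u ∷ᵥ rest) *ᶠ b +ᶠ A (v ∷ᵥ rest) *ᶠ b) +ᶠ (T (u ∷ᵥ rest) +ᶠ T (v ∷ᵥ rest))
          ≡⟨ +ᶠ-interchange _ _ _ _ ⟩
        (A (u ∷ᵥ rest) *ᶠ b +ᶠ T (u ∷ᵥ rest)) +ᶠ (A (v ∷ᵥ rest) *ᶠ b +ᶠ T (v ∷ᵥ rest))
          ≡⟨ sym (cong₂ _+ᶠ_ (cong (λ c → A (u ∷ᵥ rest) *ᶠ c +ᶠ T (u ∷ᵥ rest)) (B-indep (x₀ ∷ᵥ rest) u))
                             (cong (λ c → A (v ∷ᵥ rest) *ᶠ c +ᶠ T (v ∷ᵥ rest)) (B-indep (x₀ ∷ᵥ rest) v))) ⟩
        (A (u ∷ᵥ rest) *ᶠ B (u ∷ᵥ rest) +ᶠ T (u ∷ᵥ rest)) +ᶠ (A (v ∷ᵥ rest) *ᶠ B (v ∷ᵥ rest) +ᶠ T (v ∷ᵥ rest)) ∎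
        where
        open ≡-Reasoning
        b = B (x₀ ∷ᵥ rest)
      vanish : ∀ rest → (restrict₀ B rest == 0#) ∧ allVanishᵇ (map proj₁ cofactors) rest ≡ true →
               ∀ x₀ → A (x₀ ∷ᵥ rest) *ᶠ B (x₀ ∷ᵥ rest) +ᶠ T (x₀ ∷ᵥ rest) ≡ 0#
      vanish rest all-vanish x₀ = begin
        A (x₀ ∷ᵥ rest) *ᶠ B (x₀ ∷ᵥ rest) +ᶠ T (x₀ ∷ᵥ rest)
          ≡⟨ cong₂ _+ᶠ_ (cong (A (x₀ ∷ᵥ rest) *ᶠ_) (trans (B-indep (0ᵥ ∷ᵥ rest) x₀) (==⇒≡ (proj₁ (∧≡true⁻ all-vanish)))))
                        (vanishes rest (proj₂ (∧≡true⁻ all-vanish)) x₀) ⟩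
        A (x₀ ∷ᵥ rest) *ᶠ 0# +ᶠ 0#  ≡⟨ trans (+-identityʳ _) (zeroʳ _) ⟩
        0#                          ∎
        where open ≡-Reasoning

    all-allForms : ∀ {d} {P : (Pt d → Carrier) → Set} (I : Subset d) →
                   (∀ cs → P (formOf F (vars F I) cs)) → All P (allForms F n I)
    all-allForms I P-form = Allₚ.map⁺ (All.universal (λ cs → P-form (Vec.toList cs)) _)

    structured-term : ∀ {d r} (I : Subset (suc d)) → Proper I → ∀ cs cs′ (T : Pt (suc d) → Carrier) →
                      let S = formOf F (vars F I) cs ; R = formOf F (vars F (∁ I)) cs′ in
                      Structured r T → Structured (suc r) (λ x → S x *ᶠ R x +ᶠ T x)
    structured-term {r = r} I (I≢∅ , ∁I≢∅) cs cs′ T = by-slot₀ (zero ∈? I)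
      where
      S = formOf F (vars F I) cs
      R = formOf F (vars F (∁ I)) cs′
      by-slot₀ : Dec (zero ∈ₛ I) → Structured r T → Structured (suc r) (λ x → S x *ᶠ R x +ᶠ T x)
      by-slot₀ (yes 0∈I) = structured-step S R T (formOf-additiveIn I cs 0∈I) (formOf-independentOf (∁ I) cs′ (x∈p⇒x∉∁p 0∈I))
                                                  (formOf-multiAdditive (∁ I) cs′ ∁I≢∅)
      by-slot₀ (no 0∉I)  = structured-resp (λ x → cong (_+ᶠ T x) (*-comm (R x) (S x)))
                           ∘ structured-step R S T (formOf-additiveIn (∁ I) cs′ (x∉p⇒x∈∁p 0∉I)) (formOf-independentOf I cs 0∉I)
                                                   (formOf-multiAdditive I cs I≢∅)

    all-structured : ∀ {d} (Is : List (Subset (suc d))) → All Proper Is → All (Structured (length Is)) (randomT F n Is)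
    all-structured []       []                   = structured-zero ∷ []
    all-structured (I ∷ Is) (I-proper ∷ proper) =
      Allₚ.concat⁺ (Allₚ.map⁺ (all-allForms I λ cs →
        Allₚ.concat⁺ (Allₚ.map⁺ (all-allForms (∁ I) λ cs′ →
          Allₚ.map⁺ (All.map (structured-term I I-proper cs cs′ _) (all-structured Is proper))))))

    countValue : ∀ {d} → (Pt d → Carrier) → Carrier → ℕ
    countValue {d} T z = countᵇ (λ x → T x == z) (allPoints F d n)

    slice : ∀ {d} → (Pt (suc d) → Carrier) → Pt d → Carrier → ℕ
    slice T rest z = ∑[ x₀ ← vectors n ] χ (T (x₀ ∷ᵥ rest) == z)

    countValue-by-slices : ∀ {d} (T : Pt (suc d) → Carrier) z → countValue T z ≡ ∑[ rest ← allPoints F d n ] slice T rest z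
    countValue-by-slices {d} T z = trans (countᵇ≡∑χ _ (allPoints F (suc d) n))
      (trans (∑-allVecsOf-suc (vectors n) d _) (∑-swap (vectors n) (allPoints F d n) _))

    structured-slice-bound : ∀ {d r} (T : Pt (suc d) → Carrier) (s : Structured r T) rest →
      slice T rest 1# + q ^ n * χ (allVanishᵇ (map proj₁ (Structured.cofactors s)) rest) ≤ slice T rest 0#
    structured-slice-bound T s rest with allVanishᵇ (map proj₁ (Structured.cofactors s)) rest in all-vanish
    ... | true  = ℕₚ.≤-reflexive (begin
      slice T rest 1# + q ^ n * 1     ≡⟨ cong₂ _+_ (constant-slice 1#) (ℕₚ.*-identityʳ (q ^ n)) ⟩
      q ^ n * χ (0# == 1#) + q ^ n    ≡⟨ cong (λ b → q ^ n * χ b + q ^ n) (≢⇒==-false 0≢1) ⟩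
      q ^ n * 0 + q ^ n               ≡⟨ cong (_+ q ^ n) (ℕₚ.*-zeroʳ (q ^ n)) ⟩
      q ^ n                           ≡⟨ ℕₚ.*-identityʳ (q ^ n) ⟨
      q ^ n * 1                       ≡⟨ cong (λ b → q ^ n * χ b) (==-refl 0#) ⟨
      q ^ n * χ (0# == 0#)            ≡⟨ constant-slice 0# ⟨
      slice T rest 0#                 ∎)
      where
      open ≡-Reasoning
      constant-slice : ∀ z → slice T rest z ≡ q ^ n * χ (0# == z)
      constant-slice z = trans (∑-cong (vectors n) (λ x₀ → cong (λ c → χ (c == z)) (Structured.vanishes s rest all-vanish x₀)))
                               (∑-vectors-const n _)
    ... | false = subst (_≤ slice T rest 0#) (sym (trans (cong (slice T rest 1# +_) (ℕₚ.*-zeroʳ (q ^ n))) (ℕₚ.+-identityʳ _)))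
                        (count-level≤count-kernel (λ _ → true) (λ _ _ _ → refl) (λ x₀ → T (x₀ ∷ᵥ rest))
                                                  (Structured.additive₀ s (0ᵥ ∷ᵥ rest)) 1#)

    structured-bias-bound : ∀ {d r} (T : Pt (suc d) → Carrier) → Structured r T →
                            q ^ r * countValue T 1# + (q ^ n) ^ suc d ≤ q ^ r * countValue T 0#
    structured-bias-bound {d} {r} T s = begin
      q ^ r * countValue T 1# + q ^ n * (q ^ n) ^ d
        ≤⟨ ℕₚ.+-monoʳ-≤ (q ^ r * countValue T 1#) (ℕₚ.*-monoʳ-≤ (q ^ n) zeros-bound) ⟩
      q ^ r * countValue T 1# + q ^ n * (q ^ r * Z)
        ≡⟨ factor (q ^ r) (countValue T 1#) (q ^ n) Z ⟩
      q ^ r * (countValue T 1# + q ^ n * Z)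
        ≤⟨ ℕₚ.*-monoʳ-≤ (q ^ r) sliced ⟩
      q ^ r * countValue T 0# ∎
      where
      open ℕₚ.≤-Reasoning
      open Structured s
      Z = countCommonZeros (map proj₁ cofactors)
      factor : ∀ a b c z → a * b + c * (a * z) ≡ a * (b + c * z)
      factor = solve-∀
      zeros-bound : (q ^ n) ^ d ≤ q ^ r * Z
      zeros-bound = subst (λ k → (q ^ n) ^ d ≤ q ^ k * Z) length-cofactors (q^nd≤q^k*countCommonZeros d cofactors)
      sliced : countValue T 1# + q ^ n * Z ≤ countValue T 0#
      sliced = begin
        countValue T 1# + q ^ n * Z
          ≡⟨ cong₂ _+_ (countValue-by-slices T 1#) (sym (∑-*ˡ (allPoints F d n) (q ^ n) _)) ⟩
        ∑[ rest ← allPoints F d n ] slice T rest 1# + ∑[ rest ← allPoints F d n ] (q ^ n * χ (allVanishᵇ (map proj₁ cofactors) rest))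
          ≡⟨ ∑-+ (allPoints F d n) _ _ ⟨
        ∑[ rest ← allPoints F d n ] (slice T rest 1# + q ^ n * χ (allVanishᵇ (map proj₁ cofactors) rest))
          ≤⟨ ∑-mono (allPoints F d n) (structured-slice-bound T s) ⟩
        ∑[ rest ← allPoints F d n ] slice T rest 0#
          ≡⟨ countValue-by-slices T 0# ⟨
        countValue T 0# ∎

  -- T(x) at a point x with no zero component

  dot : List Carrier → List Carrier → Carrier
  dot cs ms = sumF F (Data.List.zipWith _*ᶠ_ cs ms)

  q*count-dot≡q^N : ∀ (ms : List Carrier) N → length ms ≡ N → Any (_≢ 0#) ms → ∀ z →
                    q * ∑[ cs ← allVecsOf elements N ] χ (dot (Vec.toList cs) ms == z) ≡ q ^ N
  q*count-dot≡q^N (m ∷ ms) (suc N) |ms|≡N m≢0∨ z with m ≟ 0#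
  ... | no m≢0 = cong (q *_) (begin
    ∑[ cs ← allVecsOf elements (suc N) ] χ (dot (Vec.toList cs) (m ∷ ms) == z)
      ≡⟨ ∑-allVecsOf-suc elements N _ ⟩
    ∑[ c ← elements ] ∑[ cs ← vectors N ] χ (c *ᶠ m +ᶠ dot (Vec.toList cs) ms == z)
      ≡⟨ ∑-swap elements (vectors N) _ ⟩
    ∑[ cs ← vectors N ] ∑[ c ← elements ] χ (c *ᶠ m +ᶠ dot (Vec.toList cs) ms == z)
      ≡⟨ ∑-cong (vectors N) (λ cs → ∑-χ-affine m m≢0 _ z) ⟩
    ∑[ _ ← vectors N ] 1
      ≡⟨ trans (∑-one (vectors N)) (length-vectors N) ⟩
    q ^ N ∎)
    where open ≡-Reasoning
  ... | yes m≡0 = begin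
    q * ∑[ cs ← allVecsOf elements (suc N) ] χ (dot (Vec.toList cs) (m ∷ ms) == z)
      ≡⟨ cong (q *_) (∑-allVecsOf-suc elements N _) ⟩
    q * ∑[ c ← elements ] ∑[ cs ← vectors N ] χ (c *ᶠ m +ᶠ dot (Vec.toList cs) ms == z)
      ≡⟨ cong (q *_) (∑-cong elements (λ c → ∑-cong (vectors N) (λ cs → cong (λ y → χ (y == z)) (drop-head c cs)))) ⟩
    q * ∑[ _ ← elements ] ∑[ cs ← vectors N ] χ (dot (Vec.toList cs) ms == z)
      ≡⟨ cong (q *_) (∑-const elements _) ⟩
    q * (q * ∑[ cs ← vectors N ] χ (dot (Vec.toList cs) ms == z))
      ≡⟨ cong (q *_) (q*count-dot≡q^N ms N (ℕₚ.suc-injective |ms|≡N) (tail m≢0∨) z) ⟩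
    q ^ suc N ∎
    where
    open ≡-Reasoning
    drop-head : ∀ c cs → c *ᶠ m +ᶠ dot (Vec.toList cs) ms ≡ dot (Vec.toList cs) ms
    drop-head c cs = trans (cong (λ y → c *ᶠ y +ᶠ dot (Vec.toList cs) ms) m≡0)
                           (trans (cong (_+ᶠ dot (Vec.toList cs) ms) (zeroʳ c)) (+-identityˡ _))
    tail : Any (_≢ 0#) (m ∷ ms) → Any (_≢ 0#) ms
    tail (here m≢0)   = ⊥-elim (m≢0 m≡0)
    tail (there m≢0∨) = m≢0∨

  *ᶠ-≢0 : ∀ {a b} → a ≢ 0# → b ≢ 0# → a *ᶠ b ≢ 0#
  *ᶠ-≢0 {a} {b} a≢0 b≢0 ab≡0 = b≢0 (begin
    b                          ≡⟨ *-identityˡ b ⟨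
    1# *ᶠ b                    ≡⟨ cong (_*ᶠ b) (trans (*-comm a⁻¹ a) (proj₂ (inverse a a≢0))) ⟨
    a⁻¹ *ᶠ a *ᶠ b              ≡⟨ *-assoc a⁻¹ a b ⟩
    a⁻¹ *ᶠ (a *ᶠ b)            ≡⟨ cong (a⁻¹ *ᶠ_) ab≡0 ⟩
    a⁻¹ *ᶠ 0#                  ≡⟨ zeroʳ a⁻¹ ⟩
    0#                         ∎)
    where
    open ≡-Reasoning
    a⁻¹ = (a ⁻¹) a≢0

  module _ {n d : ℕ} where

    NowhereZero : Pt n d → Set
    NowhereZero x = ∀ j → ∃ λ i → Vec.lookup (Vec.lookup x j) i ≢ 0#

    nonvanishingMonomial : ∀ (x : Pt n d) → NowhereZero x → (J : List (Fin d)) →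
                           Σ (Vec (Fin n) (length J)) λ k → monomial F J k x ≢ 0#
    nonvanishingMonomial x x≢0 []      = []ᵥ , 0≢1 ∘ sym
    nonvanishingMonomial x x≢0 (j ∷ J) with x≢0 j | nonvanishingMonomial x x≢0 J
    ... | i , xⱼᵢ≢0 | k , mₖ≢0 = i ∷ᵥ k , *ᶠ-≢0 xⱼᵢ≢0 mₖ≢0

    formOf≡dot : ∀ (J : List (Fin d)) cs (ks : List (Vec (Fin n) (length J))) x →
                 sumF F (Data.List.zipWith (λ c k → c *ᶠ monomial F J k x) cs ks) ≡ dot cs (map (λ k → monomial F J k x) ks)
    formOf≡dot J []       ks       x = refl
    formOf≡dot J (c ∷ cs) []       x = refl
    formOf≡dot J (c ∷ cs) (k ∷ ks) x = cong (c *ᶠ monomial F J k x +ᶠ_) (formOf≡dot J cs ks x)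

    valueCount : List (Pt n d → Carrier) → Pt n d → Carrier → ℕ
    valueCount Ts x z = ∑[ T ← Ts ] χ (T x == z)

    q*valueCount-allForms : ∀ (I : Subset d) x → NowhereZero x → ∀ z →
                            q * valueCount (allForms F n I) x z ≡ length (allForms F n I)
    q*valueCount-allForms I x x≢0 z = begin
      q * ∑[ S ← allForms F n I ] χ (S x == z)
        ≡⟨ cong (q *_) (∑-map _ (allVecsOf elements N) _) ⟩
      q * ∑[ cs ← allVecsOf elements N ] χ (formOf F J (Vec.toList cs) x == z)
        ≡⟨ cong (q *_) (∑-cong (allVecsOf elements N) (λ cs → cong (λ y → χ (y == z)) (formOf≡dot J (Vec.toList cs) ks x))) ⟩
      q * ∑[ cs ← allVecsOf elements N ] χ (dot (Vec.toList cs) ms == z)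
        ≡⟨ q*count-dot≡q^N ms N (Listₚ.length-map _ ks) nonzero-coefficient z ⟩
      q ^ N
        ≡⟨ trans (Listₚ.length-map _ (allVecsOf elements N)) (length-allVecsOf elements N) ⟨
      length (allForms F n I) ∎
      where
      open ≡-Reasoning
      J  = vars F I
      ks = multiIndices F n J
      N  = length ks
      ms = map (λ k → monomial F J k x) ks
      nonzero-coefficient : Any (_≢ 0#) ms
      nonzero-coefficient with nonvanishingMonomial x x≢0 J
      ... | k , mₖ≢0 = Anyₚ.map⁺ (lose (∈-allVecsOf (allFin n) k (λ i → Membershipₚ.∈-allFin _)) mₖ≢0)

    length-randomT : ∀ (I : Subset d) Is →
      length (randomT F n (I ∷ Is)) ≡ length (allForms F n I) * (length (allForms F n (∁ I)) * length (randomT F n Is))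
    length-randomT I Is = begin
      length (randomT F n (I ∷ Is))                          ≡⟨ length-concatMap _ A ⟩
      ∑[ S ← A ] length (concatMap (λ R → map _ L) B)       ≡⟨ ∑-cong A (λ S → length-concatMap _ B) ⟩
      ∑[ S ← A ] ∑[ R ← B ] length (map _ L)                ≡⟨ ∑-cong A (λ S → ∑-cong B (λ R → Listₚ.length-map _ L)) ⟩
      ∑[ S ← A ] ∑[ R ← B ] length L                        ≡⟨ ∑-cong A (λ S → ∑-const B _) ⟩
      ∑[ S ← A ] (length B * length L)                      ≡⟨ ∑-const A _ ⟩
      length A * (length B * length L)                      ∎
      where
      open ≡-Reasoning
      A = allForms F n I
      B = allForms F n (∁ I)
      L = randomT F n Is

    module _ (x : Pt n d) (x≢0 : NowhereZero x) (I : Subset d) (Is : List (Subset d)) where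

      private
        A = allForms F n I
        B = allForms F n (∁ I)
        L = randomT F n Is

      q*valueCount-product : ∀ (R T : Pt n d → Carrier) z →
        q * ∑[ S ← A ] χ (S x *ᶠ R x +ᶠ T x == z)
          ≡ χ (not (R x == 0#)) * length A + χ (R x == 0#) * (q * (length A * χ (T x == z)))
      q*valueCount-product R T z with R x ≟ 0#
      ... | yes Rx≡0 = begin
        q * ∑[ S ← A ] χ (S x *ᶠ R x +ᶠ T x == z)   ≡⟨ cong (q *_) (∑-cong A (λ S → cong (λ y → χ (y == z)) (absorbed S))) ⟩
        q * ∑[ _ ← A ] χ (T x == z)                 ≡⟨ cong (q *_) (∑-const A _) ⟩
        q * (length A * χ (T x == z))               ≡⟨ ℕₚ.+-identityʳ _ ⟨
        1 * (q * (length A * χ (T x == z)))         ∎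
        where
        open ≡-Reasoning
        absorbed : ∀ S → S x *ᶠ R x +ᶠ T x ≡ T x
        absorbed S = trans (cong (λ y → S x *ᶠ y +ᶠ T x) Rx≡0) (trans (cong (_+ᶠ T x) (zeroʳ (S x))) (+-identityˡ (T x)))
      ... | no Rx≢0 = begin
        q * ∑[ S ← A ] χ (affine (R x) Rx≢0 (T x) (S x) == z)
          ≡⟨ cong (q *_) (∑-cong A (λ S → cong χ (affine-== (R x) Rx≢0 (T x) (S x) z))) ⟩
        q * valueCount A x (affine⁻¹ (R x) Rx≢0 (T x) z)
          ≡⟨ q*valueCount-allForms I x x≢0 _ ⟩
        length A
          ≡⟨ ℕₚ.+-identityʳ _ ⟨
        length A + 0
          ≡⟨ ℕₚ.+-identityʳ _ ⟨
        1 * length A + 0 * (q * (length A * χ (T x == z))) ∎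
        where open ≡-Reasoning

      ∑-q*valueCount-product : ∀ R z →
        ∑[ T ← L ] (q * ∑[ S ← A ] χ (S x *ᶠ R x +ᶠ T x == z))
          ≡ χ (not (R x == 0#)) * (length A * length L) + χ (R x == 0#) * (q * (length A * valueCount L x z))
      ∑-q*valueCount-product R z = begin
        ∑[ T ← L ] (q * ∑[ S ← A ] χ (S x *ᶠ R x +ᶠ T x == z))
          ≡⟨ ∑-cong L (λ T → q*valueCount-product R T z) ⟩
        ∑[ T ← L ] (χ (not (R x == 0#)) * length A + χ (R x == 0#) * (q * (length A * χ (T x == z))))
          ≡⟨ trans (∑-+ L _ _) (cong₂ _+_ (∑-const L _) (∑-*ˡ L (χ (R x == 0#)) (λ T → q * (length A * χ (T x == z))))) ⟩
        length L * (χ (not (R x == 0#)) * length A) + χ (R x == 0#) * ∑[ T ← L ] (q * (length A * χ (T x == z)))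
          ≡⟨ cong₂ _+_ (swap (length L) (χ (not (R x == 0#))) (length A))
                       (cong (χ (R x == 0#) *_) (trans (∑-*ˡ L q _) (cong (q *_) (∑-*ˡ L (length A) _)))) ⟩
        χ (not (R x == 0#)) * (length A * length L) + χ (R x == 0#) * (q * (length A * valueCount L x z)) ∎
        where
        open ≡-Reasoning
        swap : ∀ l c a → l * (c * a) ≡ c * (a * l)
        swap = solve-∀

      q*valueCount-randomT-step : ∀ z →
        q * valueCount (randomT F n (I ∷ Is)) x z
          ≡ length A * length L * ∑[ R ← B ] χ (not (R x == 0#)) + length A * length B * valueCount L x z
      q*valueCount-randomT-step z = begin
        q * valueCount (randomT F n (I ∷ Is)) x z
          ≡⟨ cong (q *_) (trans (∑-concatMap _ A _) (∑-cong A (λ S → trans (∑-concatMap _ B _) (∑-cong B (λ R → ∑-map _ L _))))) ⟩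
        q * ∑[ S ← A ] ∑[ R ← B ] ∑[ T ← L ] χ (S x *ᶠ R x +ᶠ T x == z)
          ≡⟨ cong (q *_) (trans (∑-swap A B _) (∑-cong B (λ R → ∑-swap A L _))) ⟩
        q * ∑[ R ← B ] ∑[ T ← L ] ∑[ S ← A ] χ (S x *ᶠ R x +ᶠ T x == z)
          ≡⟨ sym (trans (∑-cong B (λ R → ∑-*ˡ L q _)) (∑-*ˡ B q _)) ⟩
        ∑[ R ← B ] ∑[ T ← L ] (q * ∑[ S ← A ] χ (S x *ᶠ R x +ᶠ T x == z))
          ≡⟨ ∑-cong B (λ R → ∑-q*valueCount-product R z) ⟩
        ∑[ R ← B ] (χ (not (R x == 0#)) * (length A * length L) + χ (R x == 0#) * (q * (length A * valueCount L x z)))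
          ≡⟨ trans (∑-+ B _ _) (cong₂ _+_ (∑-*ʳ B _ _) (∑-*ʳ B _ _)) ⟩
        ∑[ R ← B ] χ (not (R x == 0#)) * (length A * length L) + valueCount B x 0# * (q * (length A * valueCount L x z))
          ≡⟨ cong₂ _+_ (ℕₚ.*-comm _ (length A * length L)) (trans (rearrange (valueCount B x 0#) q (length A) _)
                                                                 (cong (λ k → length A * k * valueCount L x z) (q*valueCount-allForms (∁ I) x x≢0 0#))) ⟩
        length A * length L * ∑[ R ← B ] χ (not (R x == 0#)) + length A * length B * valueCount L x z
          ∎
        where
        open ≡-Reasoning
        rearrange : ∀ c q a v → c * (q * (a * v)) ≡ a * (q * c) * v
        rearrange = solve-∀

    randomT-balance : ∀ (x : Pt n d) → NowhereZero x → ∀ Is →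
      q ^ length Is * valueCount (randomT F n Is) x 0# ≡ q ^ length Is * valueCount (randomT F n Is) x 1# + length (randomT F n Is)
    randomT-balance x x≢0 [] =
      trans (cong (λ b → 1 * (χ b + 0)) (==-refl 0#)) (cong (λ b → 1 * (χ b + 0) + 1) (sym (≢⇒==-false 0≢1)))
    randomT-balance x x≢0 (I ∷ Is) = begin
      q ^ suc r * Z′ 0#                            ≡⟨ shift q (q ^ r) _ ⟩
      q ^ r * (q * Z′ 0#)                          ≡⟨ cong (q ^ r *_) (q*valueCount-randomT-step x x≢0 I Is 0#) ⟩
      q ^ r * (C + a * b * Z 0#)                   ≡⟨ lift (q ^ r) C (a * b) (Z 0#) (Z 1#) l (randomT-balance x x≢0 Is) ⟩
      q ^ r * (C + a * b * Z 1#) + a * b * l       ≡⟨ cong₂ _+_ (cong (q ^ r *_) (q*valueCount-randomT-step x x≢0 I Is 1#))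
                                                              (trans (length-randomT I Is) (sym (ℕₚ.*-assoc a b l))) ⟨
      q ^ r * (q * Z′ 1#) + length (randomT F n (I ∷ Is)) ≡⟨ cong (_+ length (randomT F n (I ∷ Is))) (shift q (q ^ r) _) ⟨
      q ^ suc r * Z′ 1# + length (randomT F n (I ∷ Is)) ∎
      where
      open ≡-Reasoning
      r = length Is
      a = length (allForms F n I)
      b = length (allForms F n (∁ I))
      l = length (randomT F n Is)
      Z  = valueCount (randomT F n Is) x
      Z′ = valueCount (randomT F n (I ∷ Is)) x
      C = a * l * ∑[ R ← allForms F n (∁ I) ] χ (not (R x == 0#))
      shift : ∀ q Q z → q * Q * z ≡ Q * (q * z)
      shift = solve-∀
      lift : ∀ Q C k Z₀ Z₁ l → Q * Z₀ ≡ Q * Z₁ + l → Q * (C + k * Z₀) ≡ Q * (C + k * Z₁) + k * l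
      lift Q C k Z₀ Z₁ l balanced = begin
        Q * (C + k * Z₀)            ≡⟨ distribute Q C k Z₀ ⟩
        Q * C + k * (Q * Z₀)        ≡⟨ cong (λ w → Q * C + k * w) balanced ⟩
        Q * C + k * (Q * Z₁ + l)    ≡⟨ regroup Q C k Z₁ l ⟩
        Q * (C + k * Z₁) + k * l    ∎
        where
        distribute : ∀ Q C k Z → Q * (C + k * Z) ≡ Q * C + k * (Q * Z)
        distribute = solve-∀
        regroup : ∀ Q C k Z l → Q * C + k * (Q * Z + l) ≡ Q * (C + k * Z) + k * l
        regroup = solve-∀

  -- The expected bias

  isZeroᵇ : ∀ {n} → Vector n → Bool
  isZeroᵇ []ᵥ       = true
  isZeroᵇ (c ∷ᵥ v) = (c == 0#) ∧ isZeroᵇ v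

  count-isZero : ∀ n → ∑ (vectors n) (χ ∘ isZeroᵇ) ≡ 1
  count-isZero zero    = refl
  count-isZero (suc n) = begin
    ∑[ v ← vectors (suc n) ] χ (isZeroᵇ v)
      ≡⟨ ∑-allVecsOf-suc elements n _ ⟩
    ∑[ c ← elements ] ∑[ v ← vectors n ] χ ((c == 0#) ∧ isZeroᵇ v)
      ≡⟨ ∑-cong elements (λ c → ∑-cong (vectors n) (λ v → χ-∧ (c == 0#) _)) ⟩
    ∑[ c ← elements ] ∑[ v ← vectors n ] (χ (c == 0#) * χ (isZeroᵇ v))
      ≡⟨ ∑-cong elements (λ c → ∑-*ˡ (vectors n) (χ (c == 0#)) (χ ∘ isZeroᵇ)) ⟩
    ∑[ c ← elements ] (χ (c == 0#) * ∑ (vectors n) (χ ∘ isZeroᵇ))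
      ≡⟨ ∑-cong elements (λ c → trans (cong (χ (c == 0#) *_) (count-isZero n)) (ℕₚ.*-identityʳ _)) ⟩
    ∑[ c ← elements ] χ (c == 0#)
      ≡⟨ ∑-χ-== 0# ⟩
    1 ∎
    where open ≡-Reasoning

  isZero-false⇒nonzero-entry : ∀ {n} (v : Vector n) → isZeroᵇ v ≡ false → ∃ λ i → Vec.lookup v i ≢ 0#
  isZero-false⇒nonzero-entry (c ∷ᵥ v) v≢0 with c ≟ 0#
  ... | no c≢0 = zero , c≢0
  ... | yes _  with isZero-false⇒nonzero-entry v v≢0
  ...   | i , vᵢ≢0 = suc i , vᵢ≢0

  hasZeroComponentᵇ : ∀ {n d} → Pt n d → Bool
  hasZeroComponentᵇ []ᵥ       = false
  hasZeroComponentᵇ (v ∷ᵥ x) = isZeroᵇ v ∨ hasZeroComponentᵇ x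

  hasZeroComponent-false⇒NowhereZero : ∀ {n d} (x : Pt n d) → hasZeroComponentᵇ x ≡ false → NowhereZero x
  hasZeroComponent-false⇒NowhereZero (v ∷ᵥ x) no-zero zero    = isZero-false⇒nonzero-entry v (proj₁ (∨≡false⁻ no-zero))
  hasZeroComponent-false⇒NowhereZero (v ∷ᵥ x) no-zero (suc j) = hasZeroComponent-false⇒NowhereZero x (proj₂ (∨≡false⁻ no-zero)) j

  count-hasZeroComponent : ∀ n d → ∑ (allPoints F d n) (χ ∘ hasZeroComponentᵇ) * q ^ n ≤ d * (q ^ n) ^ d
  count-hasZeroComponent n zero    = z≤n
  count-hasZeroComponent n (suc d) = begin
    ∑[ x ← allPoints F (suc d) n ] χ (hasZeroComponentᵇ x) * Q
      ≡⟨ cong (_* Q) (∑-allVecsOf-suc (vectors n) d _) ⟩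
    ∑[ v ← vectors n ] ∑[ x ← allPoints F d n ] χ (isZeroᵇ v ∨ hasZeroComponentᵇ x) * Q
      ≤⟨ ℕₚ.*-monoˡ-≤ Q (∑-mono (vectors n) (λ v → ∑-mono (allPoints F d n) (λ x → χ-∨ (isZeroᵇ v) _))) ⟩
    ∑[ v ← vectors n ] ∑[ x ← allPoints F d n ] (χ (isZeroᵇ v) + χ (hasZeroComponentᵇ x)) * Q
      ≡⟨ cong (_* Q) union-split ⟩
    (P * 1 + Q * Bad) * Q
      ≤⟨ ℕₚ.≤-reflexive (expand P Q Bad) ⟩
    P * Q + Q * (Bad * Q)
      ≤⟨ ℕₚ.+-monoʳ-≤ (P * Q) (ℕₚ.*-monoʳ-≤ Q (count-hasZeroComponent n d)) ⟩
    P * Q + Q * (d * P)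
      ≡⟨ collect P Q d ⟩
    suc d * (Q * P) ∎
    where
    open ℕₚ.≤-Reasoning
    Q = q ^ n
    P = (q ^ n) ^ d
    Bad = ∑ (allPoints F d n) (χ ∘ hasZeroComponentᵇ)
    union-split : ∑[ v ← vectors n ] ∑[ x ← allPoints F d n ] (χ (isZeroᵇ v) + χ (hasZeroComponentᵇ x)) ≡ P * 1 + Q * Bad
    union-split = trans (∑-cong (vectors n) per-v)
      (trans (∑-+ (vectors n) _ _) (cong₂ _+_ (trans (∑-*ˡ (vectors n) P _) (cong (P *_) (count-isZero n))) (∑-vectors-const n _)))
      where
      per-v : ∀ v → ∑[ x ← allPoints F d n ] (χ (isZeroᵇ v) + χ (hasZeroComponentᵇ x)) ≡ P * χ (isZeroᵇ v) + Bad
      per-v v = trans (∑-+ (allPoints F d n) _ _)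
                      (cong (_+ Bad) (trans (∑-const (allPoints F d n) _) (cong (_* χ (isZeroᵇ v)) (length-allPoints n d))))
    expand : ∀ P Q B → (P * 1 + Q * B) * Q ≡ P * Q + Q * (B * Q)
    expand = solve-∀
    collect : ∀ P Q d → P * Q + Q * (d * P) ≡ suc d * (Q * P)
    collect = solve-∀

  biasNumerator : ∀ {n d} → (Pt n d → Carrier) → ℕ
  biasNumerator {n} T = countValue n T 0# ∸ countValue n T 1#

  module _ (n : ℕ) {d : ℕ} (Is : List (Subset (suc d))) (proper : All Proper Is) where

    private
      L = randomT F n Is
      r = length Is
      P = (q ^ n) ^ suc d
      Bad = ∑ (allPoints F (suc d) n) (χ ∘ hasZeroComponentᵇ)
      structured = all-structured n Is proper

    countValue-1≤0 : ∀ (T : Pt n (suc d) → Carrier) → Structured n r T → countValue n T 1# ≤ countValue n T 0#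
    countValue-1≤0 T s = ℕₚ.*-cancelˡ-≤ (q ^ r) {{q^-nonZero r}} (ℕₚ.≤-trans (ℕₚ.m≤m+n _ _) (structured-bias-bound n T s))

    ∑-countValue : ∀ z → ∑[ T ← L ] countValue n T z ≡ ∑[ x ← allPoints F (suc d) n ] valueCount L x z
    ∑-countValue z = trans (∑-cong L (λ T → countᵇ≡∑χ _ (allPoints F (suc d) n))) (∑-swap L (allPoints F (suc d) n) _)

    valueCount-balance-bound : ∀ x → q ^ r * valueCount L x 0#
                                     ≤ q ^ r * valueCount L x 1# + (length L + q ^ r * (length L * χ (hasZeroComponentᵇ x)))
    valueCount-balance-bound x with hasZeroComponentᵇ x in has-zero
    ... | false = ℕₚ.≤-reflexive (trans (randomT-balance x (hasZeroComponent-false⇒NowhereZero x has-zero) Is)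
                                       (cong (q ^ r * valueCount L x 1# +_) (sym vanishing)))
      where
      vanishing : length L + q ^ r * (length L * 0) ≡ length L
      vanishing = trans (cong (λ k → length L + q ^ r * k) (ℕₚ.*-zeroʳ (length L)))
                        (trans (cong (length L +_) (ℕₚ.*-zeroʳ (q ^ r))) (ℕₚ.+-identityʳ (length L)))
    ... | true  = begin
      q ^ r * valueCount L x 0#                                         ≤⟨ ℕₚ.*-monoʳ-≤ (q ^ r) (∑-χ≤length L _) ⟩
      q ^ r * length L                                                  ≡⟨ cong (q ^ r *_) (ℕₚ.*-identityʳ (length L)) ⟨
      q ^ r * (length L * 1)                                            ≤⟨ ℕₚ.m≤n+m _ _ ⟩
      q ^ r * valueCount L x 1# + length L + q ^ r * (length L * 1)    ≡⟨ ℕₚ.+-assoc (q ^ r * valueCount L x 1#) (length L) _ ⟩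
      q ^ r * valueCount L x 1# + (length L + q ^ r * (length L * 1))  ∎
      where open ℕₚ.≤-Reasoning

    q^r*∑countValue≤ : q ^ r * ∑[ T ← L ] countValue n T 0#
                       ≤ q ^ r * ∑[ T ← L ] countValue n T 1# + (length L * P + q ^ r * (length L * Bad))
    q^r*∑countValue≤ = begin
      q ^ r * ∑[ T ← L ] countValue n T 0#                             ≡⟨ cong (q ^ r *_) (∑-countValue 0#) ⟩
      q ^ r * ∑[ x ← pts ] valueCount L x 0#                           ≡⟨ ∑-*ˡ pts (q ^ r) _ ⟨
      ∑[ x ← pts ] (q ^ r * valueCount L x 0#)                         ≤⟨ ∑-mono pts valueCount-balance-bound ⟩
      ∑[ x ← pts ] (q ^ r * valueCount L x 1# + (length L + q ^ r * (length L * χ (hasZeroComponentᵇ x))))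
        ≡⟨ trans (∑-+ pts _ _) (cong₂ _+_ (trans (∑-*ˡ pts (q ^ r) _) (cong (q ^ r *_) (sym (∑-countValue 1#)))) split) ⟩
      q ^ r * ∑[ T ← L ] countValue n T 1# + (length L * P + q ^ r * (length L * Bad)) ∎
      where
      open ℕₚ.≤-Reasoning
      pts = allPoints F (suc d) n
      split : ∑[ x ← pts ] (length L + q ^ r * (length L * χ (hasZeroComponentᵇ x))) ≡ length L * P + q ^ r * (length L * Bad)
      split = trans (∑-+ pts _ _)
        (cong₂ _+_ (trans (∑-const pts _) (trans (cong (_* length L) (length-allPoints n (suc d))) (ℕₚ.*-comm P _)))
                   (trans (∑-*ˡ pts (q ^ r) _) (cong (q ^ r *_) (∑-*ˡ pts (length L) _))))

    q^r*∑biasNumerator≤ : q ^ r * ∑ L biasNumerator ≤ length L * P + q ^ r * (length L * Bad)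
    q^r*∑biasNumerator≤ = ℕₚ.+-cancelˡ-≤ (q ^ r * C₁) _ _ (begin
      q ^ r * C₁ + q ^ r * ∑ L biasNumerator      ≡⟨ ℕₚ.*-distribˡ-+ (q ^ r) C₁ _ ⟨
      q ^ r * (C₁ + ∑ L biasNumerator)            ≡⟨ cong (q ^ r *_) (trans (ℕₚ.+-comm C₁ _) numerator+C₁) ⟩
      q ^ r * C₀                                  ≤⟨ q^r*∑countValue≤ ⟩
      q ^ r * C₁ + (length L * P + q ^ r * (length L * Bad)) ∎)
      where
      open ℕₚ.≤-Reasoning
      C₀ = ∑[ T ← L ] countValue n T 0#
      C₁ = ∑[ T ← L ] countValue n T 1#
      numerator+C₁ : ∑ L biasNumerator + C₁ ≡ C₀
      numerator+C₁ = trans (sym (∑-+ L biasNumerator _))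
                           (∑-cong-All L structured (λ T s → ℕₚ.m∸n+n≡m (countValue-1≤0 T s)))

    expected-bias-bound : q ^ r * ∑ L biasNumerator * q ^ n ≤ length L * P * (q ^ n + suc d * q ^ r)
    expected-bias-bound = begin
      q ^ r * ∑ L biasNumerator * q ^ n
        ≤⟨ ℕₚ.*-monoˡ-≤ (q ^ n) q^r*∑biasNumerator≤ ⟩
      (length L * P + q ^ r * (length L * Bad)) * q ^ n
        ≡⟨ expand (length L) P (q ^ r) Bad (q ^ n) ⟩
      length L * P * q ^ n + q ^ r * length L * (Bad * q ^ n)
        ≤⟨ ℕₚ.+-monoʳ-≤ (length L * P * q ^ n) (ℕₚ.*-monoʳ-≤ (q ^ r * length L) (count-hasZeroComponent n (suc d))) ⟩
      length L * P * q ^ n + q ^ r * length L * (suc d * P)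
        ≡⟨ collect (length L) P (q ^ r) (q ^ n) (suc d) ⟩
      length L * P * (q ^ n + suc d * q ^ r) ∎
      where
      open ℕₚ.≤-Reasoning
      expand : ∀ l P Q B N → (l * P + Q * (l * B)) * N ≡ l * P * N + Q * l * (B * N)
      expand = solve-∀
      collect : ∀ l P Q N e → l * P * N + Q * l * (e * P) ≡ l * P * (N + e * Q)
      collect = solve-∀

  -- Markov's inequality

  module _ (n : ℕ) {d : ℕ} (Is : List (Subset (suc d))) (proper : All Proper Is) (a b : ℕ) where

    private
      L = randomT F n Is
      M = length L
      r = length Is
      P = (q ^ n) ^ suc d
      structured = all-structured n Is proper

    belowThresholdᵇ : (Pt n (suc d) → Carrier) → Bool
    belowThresholdᵇ T = (bias F T ^ℚ b) ℚ.≤ᵇ ratio (ℤ.+ (q ^ a)) (q ^ (r * b))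

    highBiasᵇ : (Pt n (suc d) → Carrier) → Bool
    highBiasᵇ = not ∘ belowThresholdᵇ

    1≤|points| : 1 ≤ length (allPoints F (suc d) n)
    1≤|points| = subst (1 ≤_) (sym (length-allPoints n (suc d))) (^-positive (suc d) (1≤q^ n))

    count-arkInRange : countᵇ (arkInRangeᵇ F r a b) L + countᵇ highBiasᵇ L ≡ M
    count-arkInRange = trans (cong (_+ countᵇ highBiasᵇ L) (begin
      countᵇ (arkInRangeᵇ F r a b) L
        ≡⟨ countᵇ≡∑χ _ L ⟩
      ∑ L (χ ∘ arkInRangeᵇ F r a b)
        ≡⟨ ∑-cong-All L structured (λ T s → cong (λ x → χ (x ∧ belowThresholdᵇ T)) (lower-bound T s)) ⟩
      ∑ L (χ ∘ belowThresholdᵇ)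
        ≡⟨ countᵇ≡∑χ _ L ⟨
      countᵇ belowThresholdᵇ L ∎)) (countᵇ+countᵇ-not belowThresholdᵇ L)
      where
      open ≡-Reasoning
      lower-bound : ∀ T → Structured n r T → (ratio (ℤ.+ 1) (q ^ r) ℚ.≤ᵇ bias F T) ≡ true
      lower-bound T s = ≤⇒≤ᵇ≡true (bias≥1/Q 1≤|points| (1≤q^ r)
        (subst (λ P → q ^ r * countValue n T 1# + P ≤ q ^ r * countValue n T 0#) (sym (length-allPoints n (suc d)))
               (structured-bias-bound n T s)))

    markov-highBias : 1 ≤ b → countᵇ highBiasᵇ L ^ b * (q ^ a * P ^ b) ≤ ∑ L biasNumerator ^ b * q ^ (r * b)
    markov-highBias 1≤b =
      subst (λ f → f ^ b * (q ^ a * P ^ b) ≤ ∑ L biasNumerator ^ b * q ^ (r * b)) (sym (countᵇ≡∑χ highBiasᵇ L))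
      (markov-^ highBiasᵇ biasNumerator L b (q ^ (r * b)) (q ^ a * P ^ b) 1≤b high⇒large)
      where
      high⇒large : ∀ {T} → T ∈ L → highBiasᵇ T ≡ true → q ^ a * P ^ b ≤ biasNumerator T ^ b * q ^ (r * b)
      high⇒large {T} T∈L high = ℕₚ.<⇒≤ (subst (λ P → q ^ a * P ^ b < biasNumerator T ^ b * q ^ (r * b)) (length-allPoints n (suc d))
        (bias^b>A/B b (countValue-1≤0 n Is proper T (All.lookup structured T∈L)) 1≤|points| (1≤q^ (r * b))
                    (≤ᵇ≡false⇒≰ (not≡true⁻ high))))

    highBias-count-bound : 1 ≤ b → r ≤ n →
      let u = q ^ (n ∸ r) in countᵇ highBiasᵇ L ^ b * q ^ a * u ^ b ≤ M ^ b * (u + suc d) ^ b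
    highBias-count-bound 1≤b r≤n = ℕₚ.*-cancelʳ-≤ _ _ (P ^ b) {{>-nonZero (^-positive b (^-positive (suc d) (1≤q^ n)))}} (begin
      f ^ b * q ^ a * u ^ b * P ^ b
        ≡⟨ reorder (f ^ b) (q ^ a) (u ^ b) (P ^ b) ⟩
      f ^ b * (q ^ a * P ^ b) * u ^ b
        ≤⟨ ℕₚ.*-monoˡ-≤ (u ^ b) (markov-highBias 1≤b) ⟩
      S ^ b * q ^ (r * b) * u ^ b
        ≡⟨ cong (λ x → S ^ b * x * u ^ b) (ℕₚ.^-*-assoc q r b) ⟨
      S ^ b * Q ^ b * u ^ b
        ≡⟨ cong (_* u ^ b) (^-distribʳ-* S Q b) ⟨
      (S * Q) ^ b * u ^ b
        ≡⟨ ^-distribʳ-* (S * Q) u b ⟨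
      (S * Q * u) ^ b
        ≤⟨ ℕₚ.^-monoˡ-≤ b average ⟩
      (M * P * (u + suc d)) ^ b
        ≡⟨ trans (^-distribʳ-* (M * P) _ b) (cong (_* (u + suc d) ^ b) (^-distribʳ-* M P b)) ⟩
      M ^ b * P ^ b * (u + suc d) ^ b
        ≡⟨ reorder₂ (M ^ b) (P ^ b) ((u + suc d) ^ b) ⟩
      M ^ b * (u + suc d) ^ b * P ^ b ∎)
      where
      open ℕₚ.≤-Reasoning
      f = countᵇ highBiasᵇ L
      S = ∑ L biasNumerator
      Q = q ^ r
      u = q ^ (n ∸ r)
      reorder : ∀ f a u p → f * a * u * p ≡ f * (a * p) * u
      reorder = solve-∀
      reorder₂ : ∀ m p v → m * p * v ≡ m * v * p
      reorder₂ = solve-∀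
      q^n≡Q*u : q ^ n ≡ Q * u
      q^n≡Q*u = trans (cong (q ^_) (sym (ℕₚ.m+[n∸m]≡n r≤n))) (ℕₚ.^-distribˡ-+-* q r (n ∸ r))
      average : S * Q * u ≤ M * P * (u + suc d)
      average = ℕₚ.*-cancelˡ-≤ Q {{q^-nonZero r}} (begin
        Q * (S * Q * u)                 ≡⟨ shuffle Q S u ⟩
        Q * S * (Q * u)                 ≡⟨ cong (Q * S *_) q^n≡Q*u ⟨
        Q * S * q ^ n                   ≤⟨ expected-bias-bound n Is proper ⟩
        M * P * (q ^ n + suc d * Q)     ≡⟨ cong (λ x → M * P * (x + suc d * Q)) q^n≡Q*u ⟩
        M * P * (Q * u + suc d * Q)     ≡⟨ factor M P Q u (suc d) ⟩
        Q * (M * P * (u + suc d))       ∎)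
        where
        shuffle : ∀ Q S u → Q * (S * Q * u) ≡ Q * S * (Q * u)
        shuffle = solve-∀
        factor : ∀ M P Q u D → M * P * (Q * u + D * Q) ≡ Q * (M * P * (u + D))
        factor = solve-∀

  1≤length-randomT : ∀ n {d} (Is : List (Subset d)) → 1 ≤ length (randomT F n Is)
  1≤length-randomT n []       = s≤s z≤n
  1≤length-randomT n (I ∷ Is) = subst (1 ≤_) (sym (length-randomT I Is))
    (ℕₚ.*-mono-≤ (1≤length-allForms I) (ℕₚ.*-mono-≤ (1≤length-allForms (∁ I)) (1≤length-randomT n Is)))
    where
    1≤length-allForms : ∀ J → 1 ≤ length (allForms F n J)
    1≤length-allForms J =
      subst (1 ≤_) (sym (trans (Listₚ.length-map _ (allVecsOf elements k)) (length-allVecsOf elements k))) (1≤q^ k)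
      where k = length (multiIndices F n (vars F J))

  t≤probArkInRange : ∀ n {d} (Is : List (Subset (suc d))) → All Proper Is → ∀ a b t → 1 ≤ b →
    0ℚ ℚ.< 1ℚ ℚ.- t → ratio (ℤ.+ 1) (q ^ a) ℚ.< (1ℚ ℚ.- t) ^ℚ b →
    2 * length Is ≤ n → 2 * (ℚ.↧ₙ t ^ b * b * suc d * 2 ^ b + suc d) ≤ n →
    t ℚ.≤ probArkInRange F n (length Is) a b Is
  t≤probArkInRange n {d} Is proper a b t 1≤b 0<1-t 1/q^a<[1-t]^b 2r≤n 2[C+D]≤n =
    t≤c/M t 0<1-t (1≤length-randomT n Is) (count-arkInRange n Is proper a b)
      (f*k≤M*g b 1≤b (1≤q^ a) (ℕₚ.≤-trans (s≤s z≤n) D≤u) D≤u C≤u (↧t^b<A*gap^b t b 0<1-t (1≤q^ a) 1/q^a<[1-t]^b)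
               (highBias-count-bound n Is proper a b 1≤b (ℕₚ.≤-trans (ℕₚ.m≤m+n (length Is) _) 2r≤n)))
    where
    C = ℚ.↧ₙ t ^ b * b * suc d * 2 ^ b
    C+D<u : C + suc d < q ^ (n ∸ length Is)
    C+D<u = x<q^[n∸r] {r = length Is} 2≤q 2r≤n 2[C+D]≤n
    C≤u : C ≤ q ^ (n ∸ length Is)
    C≤u = ℕₚ.≤-trans (ℕₚ.m≤m+n C (suc d)) (ℕₚ.<⇒≤ C+D<u)
    D≤u : suc d ≤ q ^ (n ∸ length Is)
    D≤u = ℕₚ.≤-trans (ℕₚ.m≤n+m (suc d) C) (ℕₚ.<⇒≤ C+D<u)

open import Data.Nat using (ℕ; _*_; _^_) renaming (_≤_ to _≤ℕ_; _<_ to _<ℕ_)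
open import Data.Integer using (+_)
open import Data.Rational using (ℚ; 0ℚ; 1ℚ; _≤_; _<_; _-_) renaming (_*_ to _*ℚ_)
open import Data.Fin.Subset using (Subset; ∁; Nonempty)
open import Data.Fin using (Fin)
open import Data.Vec using (Vec; lookup; toList)
open import Data.Product using (∃; _×_)

open import Data.Nat using (suc; _+_; s≤s)
open import Data.Rational using (↧ₙ_)
open import Data.Product using (_,_)
open import Data.Vec.Properties using (length-toList)
open import Data.Vec.Relation.Unary.All.Properties using (toList⁺; lookup⁻)
open import Relation.Binary.PropositionalEquality using (subst; sym)
open Fractions using (2r≤n)
open ReducibleForms using (t≤probArkInRange)

corollary4p5 : (F : FiniteField) (d : ℕ) → 2 ≤ℕ d →
    (ε : ℚ) → 0ℚ < ε →
    (r : ℕ → ℕ) → (∀ n → ratio (+ r n) 1 ≤ (1ℚ - ε) *ℚ ratio (+ n) 2) →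
    (Is : (n : ℕ) → Vec (Subset d) (r n)) →
    (∀ n (i : Fin (r n)) → Nonempty (lookup (Is n) i) × Nonempty (∁ (lookup (Is n) i))) →
    (a b : ℕ) → 0 <ℕ a → 0 <ℕ b →
    (t : ℚ) → 0ℚ < 1ℚ - t →
    ratio (+ 1) (FiniteField.order F ^ a) < ((1ℚ - t) ^ℚ b) →
    ∃ λ N → ∀ n → N ≤ℕ n → t ≤ probArkInRange F n (r n) a b (toList (Is n))
corollary4p5 F (suc (suc d)) (s≤s (s≤s _)) ε 0<ε r r≤[1-ε]n/2 Is proper a b _ 1≤b t 0<1-t 1/q^a<[1-t]^b =
  2 * (↧ₙ t ^ b * b * suc (suc d) * 2 ^ b + suc (suc d)) , λ n N≤n →
    subst (λ k → t ≤ probArkInRange F n k a b (toList (Is n))) (length-toList (Is n))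
      (t≤probArkInRange F n (toList (Is n)) (toList⁺ (lookup⁻ (proper n))) a b t 1≤b 0<1-t 1/q^a<[1-t]^b
        (subst (λ k → 2 * k ≤ℕ n) (sym (length-toList (Is n))) (2r≤n {r = r n} 0<ε (r≤[1-ε]n/2 n))) N≤n)
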